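{- Let $\eta>0$, let $\ell,r,s,t\in\mathbb{N}$ with $3\le\ell\le t$, and let $H,M\in\mathbb{N}$ with $H\le M$. Let $\mathcal{K}=\mathcal{K}_{t,\ell,r}$ and $\mathcal{H}_l=\mathcal{H}_{l,\eta}$ for $l\in[r]$. Then $$\max_{\substack{n_{j\underline k\underline u}\in\mathbb{Z}:\ j\in[s],\\ \underline k\in\mathcal{K},\ \underline u\in\{0,1\}^r}}\ \mathbb{E}_{\substack{m_{j\underline k i_1\cdots i_r}\in[\pm M]:\\ j\in[s],\underline k\in\mathcal K,\ i_1,\dots,i_r\in[\ell]}}\ \mathbb{E}_{\substack{h_{lk_1\cdots k_l}\in[\pm H]:\\ l\in[r],\ k_1,\dots,k_l\in[t]}}\Big(\prod_{l\in[r]}\mathbf 1_{\mathcal H_l}\big((h_{lk_1\cdots k_l})_{k_1,\dots,k_l\in[t]}\big)\Big)\prod_{j\in[s]}\prod_{\underline k\in\mathcal K}\prod_{\underline u\in\{0,1\}^r}\mathbf 1\Big(\sum_{i_1,\dots,i_r\in[\ell]}h_{1k_{1i_1}}^{u_1}\cdots h_{rk_{1i_1}\cdots k_{ri_r}}^{u_r}m_{j\underline k i_1\cdots i_r}=n_{j\underline k\underline u}\Big)$$ is at most $C\,\eta^{ -C'}M^{ -2^rs|\mathcal K|}H^{ -r2^{r-1}s|\mathcal K|}$, where $C,C'$ depend only on $\ell,r,s,t$.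
   Context: $\mathcal{K}_{t,\ell,r}=\{(k_{li})_{(l,i)\in[r]\times[\ell]}\in[t]^{r\ell}:\ 1\le k_{l1}<\cdots<k_{l\ell}\le t\ \text{for all }l\in[r]\}$; for $\underline k\in\mathcal K$, $k_{li}$ denote its entries. For $l\in[r]$, $\mathcal{H}_{l,\eta}$ is the set of tuples $(h_{lk_1\cdots k_l})_{k_1,\dots,k_l\in[t]}\in[\pm H]^{t^l}$ such that for all pairwise distinct $(k_1,\dots,k_l),(k_1',\dots,k_l'),(k_1'',\dots,k_l'')\in[t]^l$ one has $|h_{lk_1\cdots k_l}-h_{lk''_1\cdots k''_l}|\ge\eta H$ and $\gcd(h_{lk_1\cdots k_l}-h_{lk''_1\cdots k''_l},\ h_{lk'_1\cdots k'_l}-h_{lk''_1\cdots k''_l})\le\eta^{ -1}$. $[\pm X]$ denotes the integers in $[-X,X]$; superscripts $u_i\in\{0,1\}$ are exponents; $\mathbf 1(\cdot)$ is an indicator.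
   Formalization: The parameter η ranges over the positive rationals. -}

module Defs where

open import Data.Nat as ℕ using (ℕ; zero; suc)
open import Data.Nat.GCD as NG using ()
open import Data.Integer as ℤ using (ℤ; +_)
import Data.Integer.Properties as ℤP
open import Data.Fin as F using (Fin; toℕ; inject≤)
import Data.Fin.Properties as FP
open import Data.Vec as V using (Vec; []; _∷_; lookup; tabulate)
import Data.Vec.Properties as VP
open import Data.List as L using (List; []; _∷_; concatMap; upTo; allFin; filterᵇ; length; foldr)
open import Data.Bool using (Bool; true; false; if_then_else_; _∧_; not)
open import Data.Product using (Σ; _×_; _,_)
import Data.Product.Properties as PP
open import Data.Rational as ℚ using (ℚ; _/_; 1/_; Positive)
import Data.Rational.Properties as ℚP
open import Relation.Nullary using (does)
open import Relation.Binary using (DecidableEquality)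

box : ℕ → List ℤ
box X = L.map (λ i → (+ i) ℤ.- (+ X)) (upTo (suc (2 ℕ.* X)))

vecs : {A : Set} → List A → (n : ℕ) → List (Vec A n)
vecs xs zero = [] ∷ []
vecs xs (suc n) = concatMap (λ x → L.map (x ∷_) (vecs xs n)) xs

-- all functions D → ℤ taking values in vs on the (duplicate-free) list ds
-- of points of D (and the value 0 elsewhere; such points are never used).
assignments : {D : Set} → DecidableEquality D → List D → List ℤ → List (D → ℤ)
assignments _≟_ [] vs = (λ _ → + 0) ∷ []
assignments _≟_ (d ∷ ds) vs =
  concatMap (λ v → L.map (λ f y → if does (y ≟ d) then v else f y)
                         (assignments _≟_ ds vs)) vs

count : {A : Set} → (A → Bool) → List A → ℕ
count p xs = length (filterᵇ p xs)

andAll : {A : Set} → List A → (A → Bool) → Bool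
andAll [] p = true
andAll (x ∷ xs) p = p x ∧ andAll xs p

ℕtoℚ : ℕ → ℚ
ℕtoℚ n = (+ n) / 1

ℤtoℚ : ℤ → ℚ
ℤtoℚ z = z / 1

powℚ : ℚ → ℕ → ℚ
powℚ q zero = ℚ.1ℚ
powℚ q (suc n) = q ℚ.* powℚ q n

-- The index set 𝒦_{t,ℓ,r}  (0-based: entries in Fin t, rows indexed by Fin r)

strictlyIncreasing : {t n : ℕ} → Vec (Fin t) n → Bool
strictlyIncreasing [] = true
strictlyIncreasing (x ∷ []) = true
strictlyIncreasing (x ∷ y ∷ xs) = does (x F.<? y) ∧ strictlyIncreasing (y ∷ xs)

Kidx : ℕ → ℕ → ℕ → Set
Kidx t ℓ r = Vec (Vec (Fin t) ℓ) r

𝒦 : (t ℓ r : ℕ) → List (Kidx t ℓ r)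
𝒦 t ℓ r = filterᵇ (λ k → andAll (V.toList k) strictlyIncreasing)
                  (vecs (vecs (allFin t) ℓ) r)

-- Variables h_{l k_1 ⋯ k_l}: level l ∈ Fin r (paper's l = toℕ l + 1),
-- index tuple (k_1,…,k_l) ∈ [t]^l as a vector of length toℕ l + 1.

HIdx : ℕ → ℕ → Set
HIdx t r = Σ (Fin r) (λ l → Vec (Fin t) (suc (toℕ l)))

_≟H_ : {t r : ℕ} → DecidableEquality (HIdx t r)
_≟H_ = PP.≡-dec F._≟_ (VP.≡-dec F._≟_)

hPoints : (t r : ℕ) → List (HIdx t r)
hPoints t r = concatMap (λ l → L.map (l ,_) (vecs (allFin t) (suc (toℕ l)))) (allFin r)

in𝓗 : (η : ℚ) → .{{Positive η}} → (H t r : ℕ) → Fin r → (HIdx t r → ℤ) → Bool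
in𝓗 η H t r l h =
  andAll tuples λ a → andAll tuples λ b → andAll tuples λ c →
    if distinct a b c
    then ((η ℚ.* ℕtoℚ H) ℚ.≤ᵇ ℤtoℚ (+ ℤ.∣ h (l , a) ℤ.- h (l , c) ∣))
         ∧ (ℕtoℚ (NG.gcd ℤ.∣ h (l , a) ℤ.- h (l , c) ∣ ℤ.∣ h (l , b) ℤ.- h (l , c) ∣)
             ℚ.≤ᵇ 1/_ η {{ℚP.pos⇒nonZero η}})
    else true
  where
  tuples = vecs (allFin t) (suc (toℕ l))
  neq : Vec (Fin t) (suc (toℕ l)) → Vec (Fin t) (suc (toℕ l)) → Bool
  neq x y = not (does (VP.≡-dec F._≟_ x y))
  distinct : _ → _ → _ → Bool
  distinct a b c = neq a b ∧ neq b c ∧ neq a c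

MIdx : ℕ → ℕ → ℕ → ℕ → Set
MIdx s t ℓ r = Fin s × Kidx t ℓ r × Vec (Fin ℓ) r

_≟M_ : {s t ℓ r : ℕ} → DecidableEquality (MIdx s t ℓ r)
_≟M_ = PP.≡-dec F._≟_ (PP.≡-dec (VP.≡-dec (VP.≡-dec F._≟_)) (VP.≡-dec F._≟_))

mPoints : (s t ℓ r : ℕ) → List (MIdx s t ℓ r)
mPoints s t ℓ r =
  concatMap (λ j → concatMap (λ k → L.map (λ i → j , k , i) (vecs (allFin ℓ) r))
                             (𝒦 t ℓ r))
            (allFin s)

-- the tuple (k_{1 i_1}, …, k_{l i_l}) for level l (0-based)
ktuple : {t ℓ r : ℕ} → (l : Fin r) → Kidx t ℓ r → Vec (Fin ℓ) r → Vec (Fin t) (suc (toℕ l))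
ktuple l k i = tabulate (λ p → let q = inject≤ p (FP.toℕ<n l) in lookup (lookup k q) (lookup i q))

prodℤ : List ℤ → ℤ
prodℤ = foldr ℤ._*_ (+ 1)

sumℤ : List ℤ → ℤ
sumℤ = foldr ℤ._+_ (+ 0)

linForm : {s t ℓ r : ℕ} → (HIdx t r → ℤ) → (MIdx s t ℓ r → ℤ) →
          Fin s → Kidx t ℓ r → Vec Bool r → ℤ
linForm {s} {t} {ℓ} {r} h m j k u =
  sumℤ (L.map (λ i → prodℤ (L.map (λ l → if lookup u l then h (l , ktuple l k i) else + 1)
                                  (allFin r))
                     ℤ.* m (j , k , i))
              (vecs (allFin ℓ) r))

sumℚ : List ℚ → ℚ
sumℚ = foldr ℚ._+_ ℚ.0ℚ

divℕ : ℚ → ℕ → ℚ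
divℕ q zero = ℚ.0ℚ
divℕ q (suc n) = q ℚ.* ((+ 1) / suc n)

𝔼 : {A : Set} → List A → (A → ℚ) → ℚ
𝔼 xs f = divℕ (sumℚ (L.map f xs)) (length xs)

𝟏 : Bool → ℚ
𝟏 true = ℚ.1ℚ
𝟏 false = ℚ.0ℚ

probability : (ℓ r s t : ℕ) → (η : ℚ) → .{{Positive η}} → (H M : ℕ) →
              (Fin s → Kidx t ℓ r → Vec Bool r → ℤ) → ℚ
probability ℓ r s t η H M n =
  𝔼 (assignments _≟M_ (mPoints s t ℓ r) (box M)) λ m →
  𝔼 (assignments _≟H_ (hPoints t r) (box H)) λ h →
    𝟏 (andAll (allFin r) (λ l → in𝓗 η H t r l h))
    ℚ.* 𝟏 (andAll (allFin s) λ j → andAll (𝒦 t ℓ r) λ k →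
           andAll (vecs (true ∷ false ∷ []) r) λ u →
             does (linForm h m j k u ℤ.≟ n j k u))

{-# OPTIONS --safe #-}
module Submission where

-- For fixed h ∈ 𝓗 the equations for m split into independent blocks m_{jk·} ∈ [±M]^(ℓ^r).
-- In a block, write u = (b, u′) and Z_a for the part of the sum with i₁ = a, a form of one
-- level less in the slice m_{jka·}; the equations for b = 0, 1 read Σ_a Z_a = n₀ and
-- Σ_a c_a Z_a = n₁ with c_a = h_{1 k_{1a}}. Subtracting c₂ times the first from the second,
-- two solutions satisfy α ΔZ₀ + β ΔZ₁ = 0 with α = c₀ - c₂, β = c₁ - c₂, so ΔZ₁ is a multiple
-- of |α| / gcd(α, β) ≥ η² H, and Z is determined by the bucket of Z₁ for that modulus together
-- with Z₃, …, Z_{ℓ-1}. Recursing into the slices encodes the solutions of a block injectively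
-- into at most C η^(-C′) M^(-2^r) H^(-r 2^(r-1)) (2M + 1)^(ℓ^r) codes; multiplying over the
-- blocks, summing over h and dividing by the number of pairs (m, h) gives the bound.

open import Defs
open import Data.Nat as ℕ using (ℕ; zero; suc; _+_; _*_; _≤_; _^_; _∸_; z≤n; s≤s; NonZero)
import Data.Nat.Properties as ℕP
open import Data.Nat.DivMod using (_/_; _%_; %-remove-+ʳ; /-congʳ; m≡m%n+[m/n]*n; m/n*n≡m; m/n*n≤m; /-monoˡ-≤)
open import Data.Nat.Divisibility using (_∣_; divides; *-cancelʳ-∣)
open import Data.Nat.GCD using (gcd; gcd[m,n]∣m; gcd[m,n]∣n; gcd[m,n]≢0)
open import Data.Nat.Coprimality using (Coprime; coprime-/gcd; coprime-divisor; 1-coprimeTo; recompute)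
  renaming (sym to coprime-sym)
import Data.Nat.Tactic.RingSolver as ℕSolver
open import Data.Integer as ℤ using (ℤ; +_; +[1+_]; -[1+_]; ∣_∣)
import Data.Integer.Properties as ℤP
import Data.Integer.Tactic.RingSolver as ℤSolver
open import Data.Rational as ℚ using (ℚ; mkℚ; Positive; 1/_; toℚᵘ)
import Data.Rational.Properties as ℚP
open import Data.Rational.Properties using (pos⇒nonZero)
open import Data.Rational.Unnormalised as ℚᵘ using (mkℚᵘ; *≤*)
import Data.Rational.Unnormalised.Properties as ℚᵘP
open import Data.Fin as F using (Fin; zero; suc; toℕ; inject≤)
import Data.Fin.Properties as FP
open import Data.Vec as V using (Vec; []; _∷_; lookup; _[_]≔_)
import Data.Vec.Properties as VP
open import Data.List as L using (List; []; _∷_; _++_; length; map; concatMap; filterᵇ; allFin; upTo)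
open import Data.Nat.ListAction using (sum; product)
open import Data.Nat.ListAction.Properties using (sum-++)
import Data.List.Properties as LP
open import Data.List.Membership.Propositional using (_∈_; lose; find)
open import Data.List.Membership.Propositional.Properties
  using (∈-map⁺; ∈-map⁻; ∈-++⁻; ∈-concatMap⁺; ∈-concatMap⁻; ∈-filter⁻; ∈-allFin; ∈-upTo⁺; ∈-upTo⁻)
open import Data.Vec.Membership.Propositional.Properties using (∈-toList⁺) renaming (∈-lookup to ∈-lookupᵛ)
open import Data.List.Relation.Unary.Any using (here; there; index; _─_)
import Data.List.Relation.Unary.All as All
open import Data.List.Relation.Unary.AllPairs as AllPairs using (AllPairs; []; _∷_)
import Data.List.Relation.Unary.AllPairs.Properties as AllPairsP
open import Data.List.Relation.Unary.Unique.Propositional using (Unique)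
import Data.List.Relation.Unary.Unique.Propositional.Properties as UniqueP
open import Data.Bool using (Bool; true; false; _∧_; not; if_then_else_; T)
open import Data.Bool.Properties using (T-∧)
open import Data.Unit using (⊤; tt)
open import Data.Empty using (⊥-elim; ⊥-elim-irr)
open import Data.Product using (Σ; ∃; _×_; _,_; proj₁; proj₂)
open import Data.Product.Properties using (,-injectiveˡ; ,-injectiveʳ)
open import Data.Sum using (_⊎_; inj₁; inj₂; [_,_]′)
open import Function using (_∘_; case_of_)
open import Function.Bundles using (Equivalence)
open import Relation.Binary using (DecidableEquality)
open import Relation.Binary.PropositionalEquality
open import Relation.Nullary using (¬_; yes; no; does)
open import Algebra.Properties.CommutativeSemigroup ℕP.+-commutativeSemigroup using () renaming (interchange to +-interchange; x∙yz≈y∙xz to +-leftComm)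
open import Algebra.Properties.CommutativeSemigroup ℕP.*-commutativeSemigroup using () renaming (interchange to *-interchange; xy∙z≈xz∙y to *-rightComm; x∙yz≈y∙xz to *-leftComm)
open import Algebra.Properties.AbelianGroup ℤP.+-0-abelianGroup using () renaming (∙-cancelʳ to +-cancelʳ)
open import Relation.Nullary.Decidable using (Dec; T?)

-- Counting by injective encodings

module _ {A B : Set} where

  ∈-concatMap⁺′ : (f : A → List B) {x : A} {xs : List A} {y : B} →
                  x ∈ xs → y ∈ f x → y ∈ concatMap f xs
  ∈-concatMap⁺′ f x∈xs y∈fx = ∈-concatMap⁺ f (lose x∈xs y∈fx)

  ∈-concatMap⁻′ : (f : A → List B) (xs : List A) {y : B} →
                  y ∈ concatMap f xs → ∃ λ x → x ∈ xs × y ∈ f x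
  ∈-concatMap⁻′ f xs y∈ = find (∈-concatMap⁻ f {xs} y∈)

  map-cong-∈⁻ : {f g : A → B} (xs : List A) → map f xs ≡ map g xs → ∀ {x} → x ∈ xs → f x ≡ g x
  map-cong-∈⁻ (_ ∷ _)  eq (here refl) = LP.∷-injectiveˡ eq
  map-cong-∈⁻ (_ ∷ xs) eq (there x∈) = map-cong-∈⁻ xs (LP.∷-injectiveʳ eq) x∈

  length-concatMap-const : (f : A → List B) (k : ℕ) (xs : List A) →
                           (∀ x → length (f x) ≡ k) → length (concatMap f xs) ≡ length xs * k
  length-concatMap-const f k []       _ = refl
  length-concatMap-const f k (x ∷ xs) h =
    trans (LP.length-++ (f x)) (cong₂ _+_ (h x) (length-concatMap-const f k xs h))

module _ {A : Set} where

  allPairs-++ : {R : A → A → Set} (xs ys : List A) → AllPairs R xs → AllPairs R ys →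
                (∀ {a b} → a ∈ xs → b ∈ ys → R a b) → AllPairs R (xs ++ ys)
  allPairs-++ []       ys _            Rys _     = Rys
  allPairs-++ (x ∷ xs) ys (Rx ∷ Rxs) Rys cross =
    All.tabulate head ∷ allPairs-++ xs ys Rxs Rys (cross ∘ there)
    where
    head : ∀ {b} → b ∈ xs ++ ys → _
    head {b} b∈ with ∈-++⁻ xs b∈
    ... | inj₁ b∈xs = All.lookup Rx b∈xs
    ... | inj₂ b∈ys = cross (here refl) b∈ys

  allPairs-concatMap : {X : Set} {R : A → A → Set} {S : X → X → Set} (f : X → List A) (xs : List X) →
    AllPairs S xs → (∀ x → AllPairs R (f x)) →
    (∀ {x x′} → S x x′ → ∀ {a b} → a ∈ f x → b ∈ f x′ → R a b) → AllPairs R (concatMap f xs)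
  allPairs-concatMap f []       _            _      _     = []
  allPairs-concatMap f (x ∷ xs) (Sx ∷ Sxs) inner cross =
    allPairs-++ (f x) (concatMap f xs) (inner x) (allPairs-concatMap f xs Sxs inner cross) λ a∈ b∈ →
      let x′ , x′∈ , b∈′ = ∈-concatMap⁻′ f xs b∈ in cross (All.lookup Sx x′∈) a∈ b∈′

  allPairs-map-∈ : {R S : A → A → Set} {xs : List A} →
                   (∀ {x y} → x ∈ xs → y ∈ xs → R x y → S x y) → AllPairs R xs → AllPairs S xs
  allPairs-map-∈ f []         = []
  allPairs-map-∈ f (Rx ∷ Rxs) =
    All.tabulate (λ y∈ → f (here refl) (there y∈) (All.lookup Rx y∈))
    ∷ allPairs-map-∈ (λ x∈ y∈ → f (there x∈) (there y∈)) Rxs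

  ∈-─ : ∀ {x z} (ys : List A) (x∈ys : x ∈ ys) → z ∈ ys → z ≢ x → z ∈ (ys ─ x∈ys)
  ∈-─ (_ ∷ _)  (here refl) (here refl) z≢x = ⊥-elim (z≢x refl)
  ∈-─ (_ ∷ _)  (here _)    (there z∈)  _   = z∈
  ∈-─ (_ ∷ _)  (there _)   (here z≡y)  _   = here z≡y
  ∈-─ (_ ∷ ys) (there x∈)  (there z∈)  z≢x = there (∈-─ ys x∈ z∈ z≢x)

  unique-⊆⇒length-≤ : {xs ys : List A} → Unique xs → (∀ {x} → x ∈ xs → x ∈ ys) → length xs ≤ length ys
  unique-⊆⇒length-≤ {[]}     _            _   = z≤n
  unique-⊆⇒length-≤ {x ∷ xs} {ys} (x∉xs ∷ u) sub =
    subst (suc (length xs) ≤_) (sym (LP.length-removeAt′ ys (index x∈ys)))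
      (s≤s (unique-⊆⇒length-≤ u λ z∈ → ∈-─ ys x∈ys (sub (there z∈)) λ z≡x → All.lookup x∉xs z∈ (sym z≡x)))
    where x∈ys = sub (here refl)

count-≤-by-encoding : {A C : Set} (P : A → Bool) {R : A → A → Set} (xs : List A) →
  AllPairs (λ x y → ¬ R x y) xs → (φ : A → C) (codes : List C) →
  (∀ {x} → x ∈ xs → T (P x) → φ x ∈ codes) →
  (∀ {x y} → x ∈ xs → y ∈ xs → T (P x) → T (P y) → φ x ≡ φ y → R x y) →
  count P xs ≤ length codes
count-≤-by-encoding P {R} xs separated φ codes into injective =
  subst (_≤ length codes) (LP.length-map φ selected)
    (unique-⊆⇒length-≤ (AllPairsP.map⁺ (allPairs-map-∈ distinct (AllPairsP.filter⁺ _ separated))) sub)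
  where
  selected = filterᵇ P xs
  distinct : ∀ {x y} → x ∈ selected → y ∈ selected → ¬ R x y → φ x ≢ φ y
  distinct x∈ y∈ ¬Rxy φx≡φy =
    let x∈xs , Px = ∈-filter⁻ (T? ∘ P) x∈
        y∈xs , Py = ∈-filter⁻ (T? ∘ P) y∈
    in ¬Rxy (injective x∈xs y∈xs Px Py φx≡φy)
  sub : ∀ {c} → c ∈ map φ selected → c ∈ codes
  sub c∈ with ∈-map⁻ φ c∈
  ... | x , x∈ , refl = let x∈xs , Px = ∈-filter⁻ (T? ∘ P) x∈ in into x∈xs Px

indicator : Bool → ℕ
indicator true  = 1
indicator false = 0

module _ {A : Set} where

  count≡sum-indicator : (p : A → Bool) (xs : List A) → count p xs ≡ sum (map (indicator ∘ p) xs)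
  count≡sum-indicator p []       = refl
  count≡sum-indicator p (x ∷ xs) with p x
  ... | true  = cong suc (count≡sum-indicator p xs)
  ... | false = count≡sum-indicator p xs

  count-false : (xs : List A) → count (λ _ → false) xs ≡ 0
  count-false []       = refl
  count-false (_ ∷ xs) = count-false xs

  sum-map-+ : (f g : A → ℕ) (xs : List A) → sum (map (λ x → f x + g x) xs) ≡ sum (map f xs) + sum (map g xs)
  sum-map-+ f g []       = refl
  sum-map-+ f g (x ∷ xs) = trans (cong (λ s → f x + g x + s) (sum-map-+ f g xs)) (+-interchange (f x) (g x) _ _)

  sum-map-0 : (xs : List A) → sum (map (λ _ → 0) xs) ≡ 0
  sum-map-0 []       = refl
  sum-map-0 (_ ∷ xs) = sum-map-0 xs

  sum-map-*ʳ : (k : ℕ) (f : A → ℕ) (xs : List A) → sum (map (λ x → f x * k) xs) ≡ sum (map f xs) * k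
  sum-map-*ʳ k f []       = refl
  sum-map-*ʳ k f (x ∷ xs) = trans (cong (λ s → f x * k + s) (sum-map-*ʳ k f xs)) (sym (ℕP.*-distribʳ-+ k (f x) _))

  sum-map-≤-* : (f : A → ℕ) (W V : ℕ) (xs : List A) → (∀ {x} → x ∈ xs → f x * W ≤ V) →
                sum (map f xs) * W ≤ length xs * V
  sum-map-≤-* f W V []       _ = z≤n
  sum-map-≤-* f W V (x ∷ xs) h =
    subst (_≤ V + length xs * V) (sym (ℕP.*-distribʳ-+ W (f x) _))
      (ℕP.+-mono-≤ (h (here refl)) (sum-map-≤-* f W V xs (h ∘ there)))

  product-map-* : (f g : A → ℕ) (xs : List A) → product (map (λ x → f x * g x) xs) ≡ product (map f xs) * product (map g xs)
  product-map-* f g []       = refl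
  product-map-* f g (x ∷ xs) = trans (cong ((f x * g x) *_) (product-map-* f g xs)) (*-interchange (f x) (g x) _ _)

  product-map-const : (c : ℕ) (xs : List A) → product (map (λ _ → c) xs) ≡ c ^ length xs
  product-map-const c []       = refl
  product-map-const c (_ ∷ xs) = cong (c *_) (product-map-const c xs)

  product-map-^ : (c : ℕ) (f : A → ℕ) (xs : List A) → product (map (λ x → c ^ f x) xs) ≡ c ^ sum (map f xs)
  product-map-^ c f []       = refl
  product-map-^ c f (x ∷ xs) = trans (cong (c ^ f x *_) (product-map-^ c f xs)) (sym (ℕP.^-distribˡ-+-* c (f x) _))

  product-map-mono-≤ : (f g : A → ℕ) (xs : List A) → (∀ {x} → x ∈ xs → f x ≤ g x) →
                       product (map f xs) ≤ product (map g xs)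
  product-map-mono-≤ f g []       _ = ℕP.≤-refl
  product-map-mono-≤ f g (x ∷ xs) h = ℕP.*-mono-≤ (h (here refl)) (product-map-mono-≤ f g xs (h ∘ there))

  product-map-≤-* : (f g : A → ℕ) (X : ℕ) (xs : List A) → (∀ {x} → x ∈ xs → f x * X ≤ g x) →
                    product (map f xs) * X ^ length xs ≤ product (map g xs)
  product-map-≤-* f g X xs h =
    subst (_≤ product (map g xs)) (trans (product-map-* f (λ _ → X) xs) (cong (product (map f xs) *_) (product-map-const X xs)))
      (product-map-mono-≤ (λ x → f x * X) g xs h)

module _ {A B : Set} where

  sum-map-comm : (g : A → B → ℕ) (xs : List A) (ys : List B) →
    sum (map (λ x → sum (map (g x) ys)) xs) ≡ sum (map (λ y → sum (map (λ x → g x y) xs)) ys)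
  sum-map-comm g []       ys = sym (sum-map-0 ys)
  sum-map-comm g (x ∷ xs) ys =
    trans (cong (λ s → sum (map (g x) ys) + s) (sum-map-comm g xs ys))
      (sym (sum-map-+ (g x) (λ y → sum (map (λ x → g x y) xs)) ys))

  sum-count-comm : (f : A → B → Bool) (xs : List A) (ys : List B) →
    sum (map (λ x → count (f x) ys) xs) ≡ sum (map (λ y → count (λ x → f x y) xs) ys)
  sum-count-comm f xs ys = begin
    sum (map (λ x → count (f x) ys) xs)                              ≡⟨ cong sum (LP.map-cong (λ x → count≡sum-indicator (f x) ys) xs) ⟩
    sum (map (λ x → sum (map (λ y → indicator (f x y)) ys)) xs)      ≡⟨ sum-map-comm (λ x y → indicator (f x y)) xs ys ⟩
    sum (map (λ y → sum (map (λ x → indicator (f x y)) xs)) ys)      ≡⟨ cong sum (LP.map-cong (λ y → sym (count≡sum-indicator (λ x → f x y) xs)) ys) ⟩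
    sum (map (λ y → count (λ x → f x y) xs) ys)                      ∎
    where open ≡-Reasoning

sum-map-suc : {A : Set} (f : A → ℕ) (xs : List A) → sum (map (λ x → suc (f x)) xs) ≡ length xs + sum (map f xs)
sum-map-suc f []       = refl
sum-map-suc f (x ∷ xs) = cong suc (trans (cong (λ s → f x + s) (sum-map-suc f xs)) (+-leftComm (f x) (length xs) _))

sumℤ-++ : (xs ys : List ℤ) → sumℤ (xs ++ ys) ≡ sumℤ xs ℤ.+ sumℤ ys
sumℤ-++ []       ys = sym (ℤP.+-identityˡ _)
sumℤ-++ (x ∷ xs) ys = trans (cong (λ s → x ℤ.+ s) (sumℤ-++ xs ys)) (sym (ℤP.+-assoc x _ _))

module _ {A : Set} where

  sumℤ-map-*ˡ : (k : ℤ) (f : A → ℤ) (xs : List A) → sumℤ (map (λ x → k ℤ.* f x) xs) ≡ k ℤ.* sumℤ (map f xs)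
  sumℤ-map-*ˡ k f []       = sym (ℤP.*-zeroʳ k)
  sumℤ-map-*ˡ k f (x ∷ xs) = trans (cong (λ s → k ℤ.* f x ℤ.+ s) (sumℤ-map-*ˡ k f xs)) (sym (ℤP.*-distribˡ-+ k (f x) _))

  ∣sumℤ-map∣≤ : (f : A → ℤ) (b : ℕ) (xs : List A) → (∀ x → ∣ f x ∣ ≤ b) → ∣ sumℤ (map f xs) ∣ ≤ length xs * b
  ∣sumℤ-map∣≤ f b []       _ = z≤n
  ∣sumℤ-map∣≤ f b (x ∷ xs) h = ℕP.≤-trans (ℤP.∣i+j∣≤∣i∣+∣j∣ (f x) _) (ℕP.+-mono-≤ (h x) (∣sumℤ-map∣≤ f b xs h))

module _ {A B : Set} where

  sumℤ-map-concatMap : (F : B → ℤ) (f : A → List B) (xs : List A) →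
    sumℤ (map F (concatMap f xs)) ≡ sumℤ (map (λ a → sumℤ (map F (f a))) xs)
  sumℤ-map-concatMap F f []       = refl
  sumℤ-map-concatMap F f (x ∷ xs) = begin
    sumℤ (map F (f x ++ concatMap f xs))                  ≡⟨ cong sumℤ (LP.map-++ F (f x) (concatMap f xs)) ⟩
    sumℤ (map F (f x) ++ map F (concatMap f xs))          ≡⟨ sumℤ-++ (map F (f x)) (map F (concatMap f xs)) ⟩
    sumℤ (map F (f x)) ℤ.+ sumℤ (map F (concatMap f xs)) ≡⟨ cong (λ s → sumℤ (map F (f x)) ℤ.+ s) (sumℤ-map-concatMap F f xs) ⟩
    sumℤ (map F (f x)) ℤ.+ sumℤ (map (λ a → sumℤ (map F (f a))) xs) ∎
    where open ≡-Reasoning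

module _ {A : Set} where

  length-vecs : (xs : List A) (n : ℕ) → length (vecs xs n) ≡ length xs ^ n
  length-vecs xs zero    = refl
  length-vecs xs (suc n) =
    length-concatMap-const _ _ xs λ x → trans (LP.length-map (x ∷_) (vecs xs n)) (length-vecs xs n)

  ∈-vecs : {xs : List A} {n : ℕ} (v : Vec A n) → (∀ a → a ∈ xs) → v ∈ vecs xs n
  ∈-vecs []      _   = here refl
  ∈-vecs (a ∷ v) all = ∈-concatMap⁺′ _ (all a) (∈-map⁺ (a ∷_) (∈-vecs v all))

  unique-vecs : {xs : List A} (n : ℕ) → Unique xs → Unique (vecs xs n)
  unique-vecs zero    _ = All.[] ∷ []
  unique-vecs {xs} (suc n) u =
    allPairs-concatMap (λ x → map (x ∷_) (vecs xs n)) xs u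
      (λ x → UniqueP.map⁺ (λ eq → VP.∷-injectiveʳ eq) (unique-vecs n u))
      λ x≢x′ a∈ b∈ a≡b → case ∈-map⁻ _ a∈ , ∈-map⁻ _ b∈ of λ where
        ((_ , _ , refl) , (_ , _ , refl)) → x≢x′ (VP.∷-injectiveˡ a≡b)

Bools : List Bool
Bools = true ∷ false ∷ []

∈-Bools : ∀ b → b ∈ Bools
∈-Bools true  = here refl
∈-Bools false = there (here refl)

∈-allVecsFin : ∀ {ℓ n} (i : Vec (Fin ℓ) n) → i ∈ vecs (allFin ℓ) n
∈-allVecsFin i = ∈-vecs i ∈-allFin

length-allFin : ∀ n → length (allFin n) ≡ n
length-allFin n = LP.length-tabulate {n = n} (λ i → i)

length-allVecsFin : ∀ ℓ n → length (vecs (allFin ℓ) n) ≡ ℓ ^ n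
length-allVecsFin ℓ n = trans (length-vecs (allFin ℓ) n) (cong (_^ n) (length-allFin ℓ))

module _ {D : Set} (_≟_ : DecidableEquality D) where

  private
    update : D → ℤ → (D → ℤ) → D → ℤ
    update d v f y = if does (y ≟ d) then v else f y

    update-same : ∀ d v f → update d v f d ≡ v
    update-same d v f with d ≟ d
    ... | yes _   = refl
    ... | no  d≢d = ⊥-elim (d≢d refl)

    update-other : ∀ d v f {y} → y ≢ d → update d v f y ≡ f y
    update-other d v f {y} y≢d with y ≟ d
    ... | yes y≡d = ⊥-elim (y≢d y≡d)
    ... | no  _   = refl

  Agree : List D → (D → ℤ) → (D → ℤ) → Set
  Agree ds f g = ∀ {y} → y ∈ ds → f y ≡ g y

  length-assignments : (ds : List D) (vs : List ℤ) → length (assignments _≟_ ds vs) ≡ length vs ^ length ds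
  length-assignments []       vs = refl
  length-assignments (d ∷ ds) vs = length-concatMap-const _ _ vs λ v →
    trans (LP.length-map (update d v) (assignments _≟_ ds vs)) (length-assignments ds vs)

  assignment-value : (ds : List D) (vs : List ℤ) {f : D → ℤ} → f ∈ assignments _≟_ ds vs →
                     ∀ y → f y ∈ vs ⊎ f y ≡ + 0
  assignment-value []       vs (here refl) y = inj₂ refl
  assignment-value (d ∷ ds) vs f∈ y with ∈-concatMap⁻′ (λ v → map (update d v) (assignments _≟_ ds vs)) vs f∈
  ... | v , v∈ , f∈′ with ∈-map⁻ (update d v) f∈′
  ... | g , g∈ , refl with y ≟ d
  ...   | yes _ = inj₁ v∈
  ...   | no  _ = assignment-value ds vs g∈ y

  assignments-separated : (ds : List D) (vs : List ℤ) → Unique ds → Unique vs →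
                          AllPairs (λ f g → ¬ Agree ds f g) (assignments _≟_ ds vs)
  assignments-separated []       vs _              _  = All.[] ∷ []
  assignments-separated (d ∷ ds) vs (d∉ds ∷ uds) uvs =
    allPairs-concatMap (λ v → map (update d v) (assignments _≟_ ds vs)) vs uvs
      (λ v → AllPairsP.map⁺ (AllPairs.map (λ ¬agree agree → ¬agree (agree-tail (λ {y} → agree {y})))
                                          (assignments-separated ds vs uds uvs)))
      λ v≢v′ f∈ g∈ agree → case ∈-map⁻ _ f∈ , ∈-map⁻ _ g∈ of λ where
        ((f , _ , refl) , (g , _ , refl)) →
          v≢v′ (trans (sym (update-same d _ f)) (trans (agree (here refl)) (update-same d _ g)))
    where
    d≢ : ∀ {y} → y ∈ ds → y ≢ d
    d≢ y∈ refl = All.lookup d∉ds y∈ refl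
    agree-tail : ∀ {v f g y} → Agree (d ∷ ds) (update d v f) (update d v g) → y ∈ ds → f y ≡ g y
    agree-tail {v} {f} {g} agree y∈ =
      trans (sym (update-other d v f (d≢ y∈))) (trans (agree (there y∈)) (update-other d v g (d≢ y∈)))

i+j-j≡i : ∀ i j → i ℤ.+ j ℤ.- j ≡ i
i+j-j≡i = ℤSolver.solve-∀

+B-nonneg : ∀ z B → ∣ z ∣ ≤ B → + ∣ z ℤ.+ + B ∣ ≡ z ℤ.+ + B
+B-nonneg (+ _)    B _     = refl
+B-nonneg -[1+ n ] B n<B = trans (cong (+_ ∘ ∣_∣) (ℤP.⊖-≥ n<B)) (sym (ℤP.⊖-≥ n<B))

∣+B∣≤2B : ∀ z B → ∣ z ∣ ≤ B → ∣ z ℤ.+ + B ∣ ≤ 2 * B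
∣+B∣≤2B z B ∣z∣≤B = ℕP.≤-trans (ℤP.∣i+j∣≤∣i∣+∣j∣ z (+ B))
  (subst (∣ z ∣ + B ≤_) (cong (λ b → B + b) (sym (ℕP.+-identityʳ B))) (ℕP.+-monoˡ-≤ B ∣z∣≤B))

∈-box⁺ : ∀ {z B} → ∣ z ∣ ≤ B → z ∈ box B
∈-box⁺ {z} {B} ∣z∣≤B =
  subst (_∈ box B) shift (∈-map⁺ (λ i → + i ℤ.- + B) (∈-upTo⁺ (s≤s (∣+B∣≤2B z B ∣z∣≤B))))
  where
  shift : + ∣ z ℤ.+ + B ∣ ℤ.- + B ≡ z
  shift = trans (cong (ℤ._- + B) (+B-nonneg z B ∣z∣≤B)) (i+j-j≡i z (+ B))

∈-box⁻ : ∀ {z B} → z ∈ box B → ∣ z ∣ ≤ B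
∈-box⁻ {B = B} z∈ with ∈-map⁻ (λ i → + i ℤ.- + B) z∈
... | i , i∈ , refl rewrite ℤP.[+m]-[+n]≡m⊖n i B with ℕP.≤-total i B
...   | inj₁ i≤B = subst (_≤ B) (sym (ℤP.∣⊖∣-≤ i≤B)) (ℕP.m∸n≤m B i)
...   | inj₂ B≤i = subst (_≤ B) (sym (cong ∣_∣ (ℤP.⊖-≥ B≤i)))
                     (ℕP.m≤n+o⇒m∸n≤o i B (subst (i ≤_) (cong (λ b → B + b) (ℕP.+-identityʳ B)) (ℕ.s≤s⁻¹ (∈-upTo⁻ i∈))))

length-box : ∀ B → length (box B) ≡ suc (2 * B)
length-box B = trans (LP.length-map _ (upTo (suc (2 * B)))) (LP.length-upTo _)

unique-box : ∀ B → Unique (box B)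
unique-box B = UniqueP.map⁺ (λ eq → ℤP.+-injective (+-cancelʳ (ℤ.- + B) _ _ eq)) (UniqueP.upTo⁺ (suc (2 * B)))

assignment-bounded : {D : Set} (_≟_ : DecidableEquality D) (ds : List D) {B : ℕ} {f : D → ℤ} →
                     f ∈ assignments _≟_ ds (box B) → ∀ y → ∣ f y ∣ ≤ B
assignment-bounded _≟_ ds f∈ y with assignment-value _≟_ ds _ f∈ y
... | inj₁ fy∈ = ∈-box⁻ fy∈
... | inj₂ fy≡0 rewrite fy≡0 = z≤n

choices : {C : Set} → List (List C) → List (List C)
choices []         = [] ∷ []
choices (cs ∷ css) = concatMap (λ c → map (c ∷_) (choices css)) cs

module _ {X C : Set} where

  length-choices : (cs : X → List C) (xs : List X) → length (choices (map cs xs)) ≡ product (map (length ∘ cs) xs)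
  length-choices cs []       = refl
  length-choices cs (x ∷ xs) = length-concatMap-const _ _ (cs x) λ c →
    trans (LP.length-map (c ∷_) (choices (map cs xs))) (length-choices cs xs)

  map∈choices : (f : X → C) (cs : X → List C) (xs : List X) → (∀ {x} → x ∈ xs → f x ∈ cs x) →
                map f xs ∈ choices (map cs xs)
  map∈choices f cs []       _  = here refl
  map∈choices f cs (x ∷ xs) f∈ = ∈-concatMap⁺′ _ (f∈ (here refl)) (∈-map⁺ (f x ∷_) (map∈choices f cs xs (f∈ ∘ there)))

data Code : Set where
  leaf : ℤ → Code
  node : List Code → Code

node-injective : ∀ {cs ds} → node cs ≡ node ds → cs ≡ ds
node-injective refl = refl

leaf-injective : ∀ {a b} → leaf a ≡ leaf b → a ≡ b
leaf-injective refl = refl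

private
  ∣+m-+n∣≡n∸m : ∀ {m n} → m ≤ n → ∣ + m ℤ.- + n ∣ ≡ n ∸ m
  ∣+m-+n∣≡n∸m {m} {n} m≤n = trans (cong ∣_∣ (ℤP.[+m]-[+n]≡m⊖n m n)) (ℤP.∣⊖∣-≤ m≤n)

  ordered-same-quotient⇒≡ : ∀ Q .{{_ : NonZero Q}} {x y} → x ≤ y → Q ∣ y ∸ x → x / Q ≡ y / Q → x ≡ y
  ordered-same-quotient⇒≡ Q {x} {y} x≤y Q∣y∸x eq = begin
    x                             ≡⟨ m≡m%n+[m/n]*n x Q ⟩
    x % Q + x / Q * Q             ≡⟨ cong₂ (λ r q → r + q * Q) (sym (%-remove-+ʳ x Q∣y∸x)) eq ⟩
    (x + (y ∸ x)) % Q + y / Q * Q ≡⟨ cong (λ w → w % Q + y / Q * Q) (ℕP.m+[n∸m]≡n x≤y) ⟩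
    y % Q + y / Q * Q             ≡⟨ sym (m≡m%n+[m/n]*n y Q) ⟩
    y                             ∎
    where open ≡-Reasoning

congruent∧same-quotient⇒≡ : ∀ Q .{{_ : NonZero Q}} x y → Q ∣ ∣ + x ℤ.- + y ∣ → x / Q ≡ y / Q → x ≡ y
congruent∧same-quotient⇒≡ Q x y Q∣ eq with ℕP.≤-total x y
... | inj₁ x≤y = ordered-same-quotient⇒≡ Q x≤y (subst (Q ∣_) (∣+m-+n∣≡n∸m x≤y) Q∣) eq
... | inj₂ y≤x = sym (ordered-same-quotient⇒≡ Q y≤x
                   (subst (Q ∣_) (trans (ℤP.∣i-j∣≡∣j-i∣ (+ x) (+ y)) (∣+m-+n∣≡n∸m y≤x)) Q∣) (sym eq))

αΔ₀+βΔ₁≡0⇒α/gcd∣Δ₁ : ∀ α β Δ₀ Δ₁ .{{_ : NonZero (gcd ∣ α ∣ ∣ β ∣)}} →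
                     α ℤ.* Δ₀ ℤ.+ β ℤ.* Δ₁ ≡ + 0 → (∣ α ∣ / gcd ∣ α ∣ ∣ β ∣) ∣ ∣ Δ₁ ∣
αΔ₀+βΔ₁≡0⇒α/gcd∣Δ₁ α β Δ₀ Δ₁ eq =
  coprime-divisor (coprime-/gcd ∣ α ∣ ∣ β ∣)
    (*-cancelʳ-∣ g (subst₂ _∣_ (sym (m/n*n≡m (gcd[m,n]∣m ∣ α ∣ ∣ β ∣))) regroup α∣βΔ₁))
  where
  g = gcd ∣ α ∣ ∣ β ∣
  αΔ₀≡-βΔ₁ : α ℤ.* Δ₀ ≡ ℤ.- (β ℤ.* Δ₁)
  αΔ₀≡-βΔ₁ = trans (sym (i+j-j≡i _ (β ℤ.* Δ₁))) (trans (cong (ℤ._- β ℤ.* Δ₁) eq) (ℤP.+-identityˡ _))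
  α∣βΔ₁ : ∣ α ∣ ∣ ∣ β ∣ * ∣ Δ₁ ∣
  α∣βΔ₁ = divides ∣ Δ₀ ∣ (begin
    ∣ β ∣ * ∣ Δ₁ ∣          ≡⟨ ℤP.abs-* β Δ₁ ⟨
    ∣ β ℤ.* Δ₁ ∣            ≡⟨ ℤP.∣-i∣≡∣i∣ (β ℤ.* Δ₁) ⟨
    ∣ ℤ.- (β ℤ.* Δ₁) ∣      ≡⟨ cong ∣_∣ αΔ₀≡-βΔ₁ ⟨
    ∣ α ℤ.* Δ₀ ∣            ≡⟨ ℤP.abs-* α Δ₀ ⟩
    ∣ α ∣ * ∣ Δ₀ ∣          ≡⟨ ℕP.*-comm ∣ α ∣ ∣ Δ₀ ∣ ⟩
    ∣ Δ₀ ∣ * ∣ α ∣          ∎)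
    where open ≡-Reasoning
  regroup : ∣ β ∣ * ∣ Δ₁ ∣ ≡ ∣ β ∣ / g * ∣ Δ₁ ∣ * g
  regroup = trans (cong (_* ∣ Δ₁ ∣) (sym (m/n*n≡m (gcd[m,n]∣n ∣ α ∣ ∣ β ∣)))) (*-rightComm (∣ β ∣ / g) g ∣ Δ₁ ∣)

trues : ∀ {n} → Vec Bool n → ℕ
trues []          = 0
trues (true ∷ u)  = suc (trues u)
trues (false ∷ u) = trues u

monomial : ∀ {n} → Vec Bool n → (Fin n → ℤ) → ℤ
monomial {n} u x = prodℤ (map (λ l → if lookup u l then x l else + 1) (allFin n))

monomial-∷ : ∀ {n} b (u : Vec Bool n) x → monomial (b ∷ u) x ≡ (if b then x zero else + 1) ℤ.* monomial u (x ∘ suc)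
monomial-∷ {n} b u x = cong (λ xs → (if b then x zero else + 1) ℤ.* prodℤ xs)
  (trans (LP.map-tabulate {n = n} suc (λ l → if lookup (b ∷ u) l then x l else + 1))
         (sym (LP.map-tabulate {n = n} (λ l → l) (λ l → if lookup u l then x (suc l) else + 1))))

∣monomial∣≤ : ∀ {n} (u : Vec Bool n) {x : Fin n → ℤ} {H} → (∀ l → ∣ x l ∣ ≤ H) → ∣ monomial u x ∣ ≤ H ^ trues u
∣monomial∣≤ []      _ = ℕP.≤-refl
∣monomial∣≤ (b ∷ u) {x} {H} ∣x∣≤H rewrite monomial-∷ b u x | ℤP.abs-* (if b then x zero else + 1) (monomial u (x ∘ suc))
  with b
... | true  = ℕP.*-mono-≤ (∣x∣≤H zero) (∣monomial∣≤ u (∣x∣≤H ∘ suc))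
... | false = ℕP.≤-trans (ℕP.≤-reflexive (ℕP.+-identityʳ _)) (∣monomial∣≤ u (∣x∣≤H ∘ suc))

hExponent : ℕ → ℕ
hExponent n = n * 2 ^ (n ∸ 1)

hExponent-suc : ∀ n → hExponent (suc n) ≡ 2 ^ n + (hExponent n + hExponent n)
hExponent-suc zero    = refl
hExponent-suc (suc n) = identity n (2 ^ n)
  where
  identity : ∀ n X → suc (suc n) * (X + (X + 0)) ≡ X + (X + 0) + (suc n * X + suc n * X)
  identity = ℕSolver.solve-∀

sum-trues : ∀ n → sum (map trues (vecs Bools n)) ≡ hExponent n
sum-trues zero    = refl
sum-trues (suc n) = begin
  sum (map trues (map (true ∷_) us ++ (map (false ∷_) us ++ [])))
    ≡⟨ cong sum (LP.map-++ trues (map (true ∷_) us) _) ⟩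
  sum (map trues (map (true ∷_) us) ++ map trues (map (false ∷_) us ++ []))
    ≡⟨ sum-++ (map trues (map (true ∷_) us)) _ ⟩
  sum (map trues (map (true ∷_) us)) + sum (map trues (map (false ∷_) us ++ []))
    ≡⟨ cong₂ _+_ (cong sum (sym (LP.map-∘ us))) (cong (sum ∘ map trues) (LP.++-identityʳ (map (false ∷_) us))) ⟩
  sum (map (λ u → suc (trues u)) us) + sum (map trues (map (false ∷_) us))
    ≡⟨ cong₂ _+_ (sum-map-suc trues us) (cong sum (sym (LP.map-∘ us))) ⟩
  length us + sum (map trues us) + sum (map trues us)
    ≡⟨ cong₂ (λ L s → L + s + s) (length-vecs Bools n) (sum-trues n) ⟩
  2 ^ n + hExponent n + hExponent n
    ≡⟨ trans (ℕP.+-assoc (2 ^ n) _ _) (sym (hExponent-suc n)) ⟩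
  hExponent (suc n)
    ∎
  where
  open ≡-Reasoning
  us = vecs Bools n

1+2n≤3n : ∀ {n} → 1 ≤ n → suc (2 * n) ≤ 3 * n
1+2n≤3n {n} 1≤n = subst₂ _≤_ (ℕP.+-comm (2 * n) 1) (2n+n≡3n n) (ℕP.+-monoʳ-≤ (2 * n) 1≤n)
  where
  2n+n≡3n : ∀ n → 2 * n + n ≡ 3 * n
  2n+n≡3n = ℕSolver.solve-∀

^-distribʳ-* : ∀ m n o → (m * n) ^ o ≡ m ^ o * n ^ o
^-distribʳ-* m n zero    = refl
^-distribʳ-* m n (suc o) = trans (cong (m * n *_) (^-distribʳ-* m n o)) (*-interchange m n (m ^ o) (n ^ o))

-- The exponent of η⁻¹ and the constant in length-codes-≤; as C′ and C must, they depend on ℓ only.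
ηExponent : ℕ → ℕ → ℕ
ηExponent ℓ zero    = 0
ηExponent ℓ (suc n) = 2 ^ n + 2 ^ n + ηExponent ℓ n * ℓ

codeConstant : ℕ → ℕ → ℕ
codeConstant ℓ′ zero    = 1
codeConstant ℓ′ (suc n) = (3 ^ suc ℓ′ * (ℓ ^ n) ^ suc ℓ′) ^ 2 ^ n * codeConstant ℓ′ n ^ ℓ
  where ℓ = suc (suc (suc ℓ′))

combine-bounds : ∀ {a b x y w v W V R} .{{_ : NonZero R}} → a * x ≤ y → b * w ≤ v →
                 x * w ≡ W * R → y * v ≡ V * R → a * b * W ≤ V
combine-bounds {a} {b} {x} {y} {w} {v} {W} {V} {R} ax≤y bw≤v xw≡WR yv≡VR = ℕP.*-cancelʳ-≤ _ _ R (begin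
  a * b * W * R     ≡⟨ ℕP.*-assoc (a * b) W R ⟩
  a * b * (W * R)   ≡⟨ cong (a * b *_) xw≡WR ⟨
  a * b * (x * w)   ≡⟨ *-interchange a b x w ⟩
  a * x * (b * w)   ≤⟨ ℕP.*-mono-≤ ax≤y bw≤v ⟩
  y * v             ≡⟨ yv≡VR ⟩
  V * R             ∎)
  where open ℕP.≤-Reasoning

^-distribʳ-*³ : ∀ a b c k → (a * b * c) ^ k ≡ a ^ k * b ^ k * c ^ k
^-distribʳ-*³ a b c k = trans (^-distribʳ-* (a * b) c k) (cong (_* c ^ k) (^-distribʳ-* a b k))

^-distribˡ-+-*³ : ∀ b x y z → b ^ (x + y + z) ≡ b ^ x * b ^ y * b ^ z
^-distribˡ-+-*³ b x y z = trans (ℕP.^-distribˡ-+-* b (x + y) z) (cong (_* b ^ z) (ℕP.^-distribˡ-+-* b x y))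

cong₃ : ∀ (f : ℕ → ℕ → ℕ → ℕ) {a b c a′ b′ c′} → a ≡ a′ → b ≡ b′ → c ≡ c′ → f a b c ≡ f a′ b′ c′
cong₃ f refl refl refl = refl

private
  *3+≡ : ∀ ℓ′ N → N * suc (suc (suc ℓ′)) ≡ N + N + N * suc ℓ′
  *3+≡ = ℕSolver.solve-∀

  ^*3+≡ : ∀ ℓ′ b N → (b ^ N) ^ suc (suc (suc ℓ′)) ≡ b ^ N * b ^ N * b ^ (N * suc ℓ′)
  ^*3+≡ ℓ′ b N = trans (ℕP.^-*-assoc b N _) (trans (cong (b ^_) (*3+≡ ℓ′ N)) (^-distribˡ-+-*³ b N N _))

-- In the step from n to n + 1 levels both sides of the bound acquire the common factor
-- M ^ (N * (ℓ - 2)) * H ^ (S * (ℓ - 2)), with N = 2 ^ n and S = n * 2 ^ (n - 1).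
weight-step : ∀ ℓ′ p M H N S E →
  (p * p * H) ^ N * (p ^ E * M ^ N * H ^ S) ^ suc (suc (suc ℓ′))
  ≡ p ^ (N + N + E * suc (suc (suc ℓ′))) * M ^ (2 * N) * H ^ (N + (S + S)) * (M ^ (N * suc ℓ′) * H ^ (S * suc ℓ′))
weight-step ℓ′ p M H N S E = begin
  (p * p * H) ^ N * (p ^ E * M ^ N * H ^ S) ^ ℓ
    ≡⟨ cong₂ _*_ (^-distribʳ-*³ p p H N)
         (trans (^-distribʳ-*³ (p ^ E) (M ^ N) (H ^ S) ℓ) (cong₃ (λ x y z → x * y * z) (ℕP.^-*-assoc p E ℓ) (^*3+≡ ℓ′ M N) (^*3+≡ ℓ′ H S))) ⟩
  p ^ N * p ^ N * H ^ N * (p ^ (E * ℓ) * (M ^ N * M ^ N * M ^ (N * suc ℓ′)) * (H ^ S * H ^ S * H ^ (S * suc ℓ′)))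
    ≡⟨ regroup (p ^ N) (H ^ N) (p ^ (E * ℓ)) (M ^ N) (M ^ (N * suc ℓ′)) (H ^ S) (H ^ (S * suc ℓ′)) ⟩
  p ^ N * p ^ N * p ^ (E * ℓ) * (M ^ N * M ^ N) * (H ^ N * (H ^ S * H ^ S)) * (M ^ (N * suc ℓ′) * H ^ (S * suc ℓ′))
    ≡⟨ cong (_* (M ^ (N * suc ℓ′) * H ^ (S * suc ℓ′))) (cong₃ (λ x y z → x * y * z)
         (sym (^-distribˡ-+-*³ p N N (E * ℓ))) (sym (trans (cong (λ k → M ^ (N + k)) (ℕP.+-identityʳ N)) (ℕP.^-distribˡ-+-* M N N)))
         (sym (trans (ℕP.^-distribˡ-+-* H N (S + S)) (cong (H ^ N *_) (ℕP.^-distribˡ-+-* H S S))))) ⟩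
  p ^ (N + N + E * ℓ) * M ^ (2 * N) * H ^ (N + (S + S)) * (M ^ (N * suc ℓ′) * H ^ (S * suc ℓ′))
    ∎
  where
  open ≡-Reasoning
  ℓ = suc (suc (suc ℓ′))
  regroup : ∀ pN hN pE mN mR hS hR →
    pN * pN * hN * (pE * (mN * mN * mR) * (hS * hS * hR)) ≡ pN * pN * pE * (mN * mN) * (hN * (hS * hS)) * (mR * hR)
  regroup = ℕSolver.solve-∀

volume-step : ∀ ℓ′ A d M H N S K Y L E →
  (A * (d * d) * M ^ suc ℓ′) ^ N * H ^ (S * suc ℓ′) * (K * d ^ E * Y ^ L) ^ suc (suc (suc ℓ′))
  ≡ A ^ N * K ^ suc (suc (suc ℓ′)) * d ^ (N + N + E * suc (suc (suc ℓ′))) * Y ^ (L * suc (suc (suc ℓ′)))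
    * (M ^ (N * suc ℓ′) * H ^ (S * suc ℓ′))
volume-step ℓ′ A d M H N S K Y L E = begin
  (A * (d * d) * M ^ suc ℓ′) ^ N * H ^ (S * suc ℓ′) * (K * d ^ E * Y ^ L) ^ ℓ
    ≡⟨ cong₂ (λ x y → x * H ^ (S * suc ℓ′) * y)
         (trans (^-distribʳ-*³ A (d * d) (M ^ suc ℓ′) N) (cong₂ (λ x y → A ^ N * x * y) (^-distribʳ-* d d N)
                (trans (ℕP.^-*-assoc M (suc ℓ′) N) (cong (M ^_) (ℕP.*-comm (suc ℓ′) N)))))
         (trans (^-distribʳ-*³ K (d ^ E) (Y ^ L) ℓ) (cong₂ (λ x y → K ^ ℓ * x * y) (ℕP.^-*-assoc d E ℓ) (ℕP.^-*-assoc Y L ℓ))) ⟩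
  A ^ N * (d ^ N * d ^ N) * M ^ (N * suc ℓ′) * H ^ (S * suc ℓ′) * (K ^ ℓ * d ^ (E * ℓ) * Y ^ (L * ℓ))
    ≡⟨ regroup (A ^ N) (d ^ N) (M ^ (N * suc ℓ′)) (H ^ (S * suc ℓ′)) (K ^ ℓ) (d ^ (E * ℓ)) (Y ^ (L * ℓ)) ⟩
  A ^ N * K ^ ℓ * (d ^ N * d ^ N * d ^ (E * ℓ)) * Y ^ (L * ℓ) * (M ^ (N * suc ℓ′) * H ^ (S * suc ℓ′))
    ≡⟨ cong (λ x → A ^ N * K ^ ℓ * x * Y ^ (L * ℓ) * (M ^ (N * suc ℓ′) * H ^ (S * suc ℓ′))) (sym (^-distribˡ-+-*³ d N N (E * ℓ))) ⟩
  A ^ N * K ^ ℓ * d ^ (N + N + E * ℓ) * Y ^ (L * ℓ) * (M ^ (N * suc ℓ′) * H ^ (S * suc ℓ′))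
    ∎
  where
  open ≡-Reasoning
  ℓ = suc (suc (suc ℓ′))
  regroup : ∀ aN dN mR hR kL dE yL →
    aN * (dN * dN) * mR * hR * (kL * dE * yL) ≡ aN * kL * (dN * dN * dE) * yL * (mR * hR)
  regroup = ℕSolver.solve-∀

-- q = a / D; ℕ.pred would read D = 0 as 1, so the lemmas assume D ≠ 0.
infix 4 _≃_∕_
record _≃_∕_ (q : ℚ) (a D : ℕ) : Set where
  constructor fraction
  field
    cross-≃ : toℚᵘ q ℚᵘ.≃ mkℚᵘ (+ a) (ℕ.pred D)

ℕtoℚ≡mkℚ : ∀ a → ℕtoℚ a ≡ mkℚ (+ a) 0 (coprime-sym (1-coprimeTo a))
ℕtoℚ≡mkℚ a = ℚP.↥p/↧p≡p _

ℕtoℚ-≃ : ∀ a → ℕtoℚ a ≃ a ∕ 1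
ℕtoℚ-≃ a = fraction (ℚᵘP.≃-reflexive (cong toℚᵘ (ℕtoℚ≡mkℚ a)))

1/-≃ : ∀ D .{{_ : NonZero D}} → + 1 ℚ./ D ≃ 1 ∕ D
1/-≃ (suc k) = fraction (ℚᵘP.≃-reflexive (cong toℚᵘ (ℚP.↥p/↧p≡p (mkℚ (+ 1) k (1-coprimeTo (suc k))))))

≃-* : ∀ {x y a c D D′} .{{_ : NonZero D}} .{{_ : NonZero D′}} → x ≃ a ∕ D → y ≃ c ∕ D′ → x ℚ.* y ≃ a * c ∕ (D * D′)
≃-* {x} {y} {a} {c} {suc b} {suc e} (fraction x≃) (fraction y≃) = fraction
  (ℚᵘP.≃-trans (ℚP.toℚᵘ-homo-* x y) (ℚᵘP.≃-trans (ℚᵘP.*-cong x≃ y≃)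
    (ℚᵘP.≃-reflexive (cong (λ n → mkℚᵘ n (ℕ.pred (suc b * suc e))) (sym (ℤP.pos-* a c))))))

powℚ-≃ : ∀ {q a D} .{{_ : NonZero D}} → q ≃ a ∕ D → ∀ n → powℚ q n ≃ a ^ n ∕ D ^ n
powℚ-≃                 q≃ zero    = fraction ℚᵘP.≃-refl
powℚ-≃ {D = D} {{D≢0}} q≃ (suc n) = ≃-* {{D≢0}} {{ℕP.m^n≢0 D n {{D≢0}}}} q≃ (powℚ-≃ q≃ n)

≃-*ℕ : ∀ {x a D} .{{_ : NonZero D}} → x ≃ a ∕ D → ∀ b → x ℚ.* ℕtoℚ b ≃ a * b ∕ D
≃-*ℕ {x} {a} {D} x≃ b = subst (λ E → x ℚ.* ℕtoℚ b ≃ a * b ∕ E) (ℕP.*-identityʳ D) (≃-* x≃ (ℕtoℚ-≃ b))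

ℕ*-≃ : ∀ a {y c D} .{{_ : NonZero D}} → y ≃ c ∕ D → ℕtoℚ a ℚ.* y ≃ a * c ∕ D
ℕ*-≃ a {y} {c} {D} y≃ = subst (λ E → ℕtoℚ a ℚ.* y ≃ a * c ∕ E) (ℕP.*-identityˡ D) (≃-* (ℕtoℚ-≃ a) y≃)

≃-*1/ : ∀ {x a D} .{{_ : NonZero D}} → x ≃ a ∕ D → ∀ E .{{_ : NonZero E}} → x ℚ.* (+ 1 ℚ./ E) ≃ a ∕ (D * E)
≃-*1/ {x} {a} {D} x≃ E = subst (λ b → x ℚ.* (+ 1 ℚ./ E) ≃ b ∕ (D * E)) (ℕP.*-identityʳ a) (≃-* x≃ (1/-≃ E))

ℕ*1/-≃ : ∀ a D .{{_ : NonZero D}} → ℕtoℚ a ℚ.* (+ 1 ℚ./ D) ≃ a ∕ D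
ℕ*1/-≃ a D = subst (λ E → ℕtoℚ a ℚ.* (+ 1 ℚ./ D) ≃ a ∕ E) (ℕP.*-identityˡ D) (≃-*1/ (ℕtoℚ-≃ a) D)

≃-≤ : ∀ {x y a c D D′} .{{_ : NonZero D}} .{{_ : NonZero D′}} → x ≃ a ∕ D → y ≃ c ∕ D′ → a * D′ ≤ c * D → x ℚ.≤ y
≃-≤ {a = a} {c} {suc b} {suc e} (fraction x≃) (fraction y≃) ≤ =
  ℚP.toℚᵘ-cancel-≤ (ℚᵘP.≤-respˡ-≃ (ℚᵘP.≃-sym x≃) (ℚᵘP.≤-respʳ-≃ (ℚᵘP.≃-sym y≃)
    (*≤* (subst₂ ℤ._≤_ (ℤP.pos-* a (suc e)) (ℤP.pos-* c (suc b)) (ℤ.+≤+ ≤)))))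

≃-≤⁻ : ∀ {x y a c D D′} .{{_ : NonZero D}} .{{_ : NonZero D′}} → x ≃ a ∕ D → y ≃ c ∕ D′ → x ℚ.≤ y → a * D′ ≤ c * D
≃-≤⁻ {a = a} {c} {suc b} {suc e} (fraction x≃) (fraction y≃) x≤y
  with ℚᵘP.≤-respˡ-≃ x≃ (ℚᵘP.≤-respʳ-≃ y≃ (ℚP.toℚᵘ-mono-≤ x≤y))
... | *≤* ≤ = ℤP.drop‿+≤+ (subst₂ ℤ._≤_ (sym (ℤP.pos-* a (suc e))) (sym (ℤP.pos-* c (suc b))) ≤)

ℕtoℚ-+ : ∀ a b → ℕtoℚ (a + b) ≡ ℕtoℚ a ℚ.+ ℕtoℚ b
ℕtoℚ-+ a b = trans (cong (ℚ._/ 1) (sym (cong₂ ℤ._+_ (ℤP.*-identityʳ (+ a)) (ℤP.*-identityʳ (+ b)))))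
                   (sym (cong₂ ℚ._+_ (ℕtoℚ≡mkℚ a) (ℕtoℚ≡mkℚ b)))

module _ {A : Set} where

  sumℚ-map-ℕtoℚ : (g : A → ℕ) (xs : List A) → sumℚ (map (λ x → ℕtoℚ (g x)) xs) ≡ ℕtoℚ (sum (map g xs))
  sumℚ-map-ℕtoℚ g []       = refl
  sumℚ-map-ℕtoℚ g (x ∷ xs) = trans (cong (ℕtoℚ (g x) ℚ.+_) (sumℚ-map-ℕtoℚ g xs)) (sym (ℕtoℚ-+ (g x) _))

  sumℚ-map-*ʳ : (f : A → ℚ) (c : ℚ) (xs : List A) → sumℚ (map (λ x → f x ℚ.* c) xs) ≡ sumℚ (map f xs) ℚ.* c
  sumℚ-map-*ʳ f c []       = sym (ℚP.*-zeroˡ c)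
  sumℚ-map-*ʳ f c (x ∷ xs) = trans (cong (f x ℚ.* c ℚ.+_) (sumℚ-map-*ʳ f c xs)) (sym (ℚP.*-distribʳ-+ c (f x) _))

𝟏*𝟏≡ℕtoℚ-indicator : ∀ a b → 𝟏 a ℚ.* 𝟏 b ≡ ℕtoℚ (indicator (a ∧ b))
𝟏*𝟏≡ℕtoℚ-indicator true  true  = refl
𝟏*𝟏≡ℕtoℚ-indicator true  false = refl
𝟏*𝟏≡ℕtoℚ-indicator false true  = refl
𝟏*𝟏≡ℕtoℚ-indicator false false = refl

divℕ≡ : ∀ q L .{{_ : NonZero L}} → divℕ q L ≡ q ℚ.* (+ 1 ℚ./ L)
divℕ≡ q (suc L) = refl

-- Encoding the solutions of one block

-- Throughout, η = p / d.
module Encoding (ℓ′ p d H M : ℕ) .{{_ : NonZero p}} .{{_ : NonZero H}} where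

  ℓ : ℕ
  ℓ = suc (suc (suc ℓ′))

  pattern #0 = zero
  pattern #1 = suc zero
  pattern #2 = suc (suc zero)
  pattern #3+ a = suc (suc (suc a))

  pairForm : (c z : Fin ℓ → ℤ) → Bool → ℤ
  pairForm c z b = sumℤ (map (λ a → (if b then c a else + 1) ℤ.* z a) (allFin ℓ))

  α β : (Fin ℓ → ℤ) → ℤ
  α c = c #0 ℤ.- c #2
  β c = c #1 ℤ.- c #2

  WellSpread : (Fin ℓ → ℤ) → Set
  WellSpread c = p * H ≤ d * ∣ α c ∣ × p * gcd ∣ α c ∣ ∣ β c ∣ ≤ d

  WellSpread⇒∣α∣≢0 : ∀ {c} → WellSpread c → ∣ α c ∣ ≢ 0
  WellSpread⇒∣α∣≢0 {c} (pH≤d∣α∣ , _) ∣α∣≡0 = ℕP.<⇒≱ (ℕP.*-mono-≤ (ℕ.>-nonZero⁻¹ p) (ℕ.>-nonZero⁻¹ H))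
    (subst (p * H ≤_) (trans (cong (d *_) ∣α∣≡0) (ℕP.*-zeroʳ d)) pH≤d∣α∣)

  -- suc ∘ pred makes the modulus syntactically nonzero; for well-spread c it is ∣α∣ / gcd(∣α∣, ∣β∣).
  modulus : (Fin ℓ → ℤ) → ℕ
  modulus c = suc (ℕ.pred (∣ α c ∣ / suc (ℕ.pred (gcd ∣ α c ∣ ∣ β c ∣))))

  module Modulus (c : Fin ℓ → ℤ) (∣α∣≢0 : ∣ α c ∣ ≢ 0) where

    g : ℕ
    g = gcd ∣ α c ∣ ∣ β c ∣

    instance
      g-nonZero : NonZero g
      g-nonZero = ℕ.≢-nonZero (gcd[m,n]≢0 _ _ (inj₁ ∣α∣≢0))

    private
      quotient*g≡∣α∣ : ∣ α c ∣ / g * g ≡ ∣ α c ∣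
      quotient*g≡∣α∣ = m/n*n≡m (gcd[m,n]∣m _ _)

      quotient≢0 : ∣ α c ∣ / g ≢ 0
      quotient≢0 q≡0 = ∣α∣≢0 (trans (sym quotient*g≡∣α∣) (cong (_* g) q≡0))

    modulus≡∣α∣/g : modulus c ≡ ∣ α c ∣ / g
    modulus≡∣α∣/g = trans (cong (λ n → ℕ.suc (ℕ.pred n)) (/-congʳ {m = ∣ α c ∣} (ℕP.suc-pred g)))
                          (ℕP.suc-pred (∣ α c ∣ / g) {{ℕ.≢-nonZero quotient≢0}})

    modulus*g≡∣α∣ : modulus c * g ≡ ∣ α c ∣
    modulus*g≡∣α∣ = trans (cong (_* g) modulus≡∣α∣/g) quotient*g≡∣α∣

    modulus∣Δ₁ : ∀ Δ₀ Δ₁ → α c ℤ.* Δ₀ ℤ.+ β c ℤ.* Δ₁ ≡ + 0 → modulus c ∣ ∣ Δ₁ ∣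
    modulus∣Δ₁ Δ₀ Δ₁ eq = subst (_∣ ∣ Δ₁ ∣) (sym modulus≡∣α∣/g) (αΔ₀+βΔ₁≡0⇒α/gcd∣Δ₁ (α c) (β c) Δ₀ Δ₁ eq)

  Bounded : ℕ → (Fin ℓ → ℤ) → Set
  Bounded B z = ∀ a → ∣ z a ∣ ≤ B

  bucket : (Fin ℓ → ℤ) → ℕ → ℤ → ℕ
  bucket c B x = ∣ x ℤ.+ + B ∣ / modulus c

  tailCode : (Fin ℓ → ℤ) → List Code
  tailCode z = map (λ a → leaf (z (#3+ a))) (allFin ℓ′)

  tailCodes : ℕ → List (List Code)
  tailCodes B = choices (map (λ _ → map leaf (box B)) (allFin ℓ′))

  pairCode : (Fin ℓ → ℤ) → ℕ → (Fin ℓ → ℤ) → Code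
  pairCode c B z = node (leaf (+ bucket c B (z #1)) ∷ tailCode z)

  pairCodes : (Fin ℓ → ℤ) → ℕ → List Code
  pairCodes c B = map node (concatMap (λ q → map (leaf (+ q) ∷_) (tailCodes B)) (upTo (suc (2 * B / modulus c))))

  pairCode∈pairCodes : ∀ c {B z} → Bounded B z → pairCode c B z ∈ pairCodes c B
  pairCode∈pairCodes c {B} {z} bounded =
    ∈-map⁺ node (∈-concatMap⁺′ _ (∈-upTo⁺ (s≤s (/-monoˡ-≤ (modulus c) (∣+B∣≤2B (z #1) B (bounded #1)))))
      (∈-map⁺ _ (map∈choices _ _ (allFin ℓ′) λ {a} _ → ∈-map⁺ leaf (∈-box⁺ (bounded (#3+ a))))))

  length-pairCodes : ∀ c B → length (pairCodes c B) ≡ suc (2 * B / modulus c) * suc (2 * B) ^ ℓ′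
  length-pairCodes c B = begin
    length (pairCodes c B)
      ≡⟨ LP.length-map node (concatMap (λ q → map (leaf (+ q) ∷_) (tailCodes B)) (upTo (suc (2 * B / modulus c)))) ⟩
    length (concatMap (λ q → map (leaf (+ q) ∷_) (tailCodes B)) (upTo (suc (2 * B / modulus c))))
      ≡⟨ length-concatMap-const (λ q → map (leaf (+ q) ∷_) (tailCodes B)) (length (tailCodes B)) (upTo (suc (2 * B / modulus c))) (λ q → LP.length-map (leaf (+ q) ∷_) (tailCodes B)) ⟩
    length (upTo (suc (2 * B / modulus c))) * length (tailCodes B)
      ≡⟨ cong₂ _*_ (LP.length-upTo (suc (2 * B / modulus c))) (length-choices (λ _ → map leaf (box B)) (allFin ℓ′)) ⟩
    suc (2 * B / modulus c) * product (map (λ _ → length (map leaf (box B))) (allFin ℓ′))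
      ≡⟨ cong (λ n → suc (2 * B / modulus c) * n) (trans
           (cong product (LP.map-cong (λ _ → trans (LP.length-map leaf (box B)) (length-box B)) (allFin ℓ′)))
           (trans (product-map-const _ (allFin ℓ′)) (cong (suc (2 * B) ^_) (length-allFin ℓ′)))) ⟩
    suc (2 * B / modulus c) * suc (2 * B) ^ ℓ′
      ∎
    where open ≡-Reasoning

  private
    coeff : (Fin ℓ → ℤ) → Bool → Fin ℓ → ℤ
    coeff c b a = if b then c a else + 1

    tailSum : (c z : Fin ℓ → ℤ) → Bool → ℤ
    tailSum c z b = sumℤ (map (λ a → coeff c b a ℤ.* z a) (L.tabulate (λ a → #3+ a)))

    elimination : ∀ c₀ c₁ c₂ z₀ z₁ z₂ w₀ w₁ w₂ r₀ r₁ →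
      (c₀ ℤ.- c₂) ℤ.* (z₀ ℤ.- w₀) ℤ.+ (c₁ ℤ.- c₂) ℤ.* (z₁ ℤ.- w₁)
      ≡ ((c₀ ℤ.* z₀ ℤ.+ (c₁ ℤ.* z₁ ℤ.+ (c₂ ℤ.* z₂ ℤ.+ r₁))) ℤ.- (c₀ ℤ.* w₀ ℤ.+ (c₁ ℤ.* w₁ ℤ.+ (c₂ ℤ.* w₂ ℤ.+ r₁))))
        ℤ.- c₂ ℤ.* ((+ 1 ℤ.* z₀ ℤ.+ (+ 1 ℤ.* z₁ ℤ.+ (+ 1 ℤ.* z₂ ℤ.+ r₀)))
                    ℤ.- (+ 1 ℤ.* w₀ ℤ.+ (+ 1 ℤ.* w₁ ℤ.+ (+ 1 ℤ.* w₂ ℤ.+ r₀))))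
    elimination = ℤSolver.solve-∀

    isolate : ∀ a b z w r → z ℤ.- w ≡ (+ 1 ℤ.* a ℤ.+ (+ 1 ℤ.* b ℤ.+ (+ 1 ℤ.* z ℤ.+ r)))
                                    ℤ.- (+ 1 ℤ.* a ℤ.+ (+ 1 ℤ.* b ℤ.+ (+ 1 ℤ.* w ℤ.+ r)))
    isolate = ℤSolver.solve-∀

    shift-diff : ∀ x y B → (x ℤ.+ B) ℤ.- (y ℤ.+ B) ≡ x ℤ.- y
    shift-diff = ℤSolver.solve-∀

  -- Eliminating z₂ leaves α Δ₀ + β Δ₁ = 0 for Δ = z - z′, so Δ₁ is a multiple of the
  -- modulus and the bucket fixes it.
  pairCode-injective : ∀ {c B z z′} → WellSpread c → Bounded B z → Bounded B z′ →
    (∀ b → pairForm c z b ≡ pairForm c z′ b) → pairCode c B z ≡ pairCode c B z′ → ∀ a → z a ≡ z′ a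
  pairCode-injective {c} {B} {z} {z′} spread bz bz′ same-forms same-code = equal
    where
    ∣α∣≢0 = WellSpread⇒∣α∣≢0 {c} spread
    open Modulus c ∣α∣≢0 using (modulus∣Δ₁)
    codes = LP.∷-injective (node-injective same-code)

    tail≡ : ∀ a → z (#3+ a) ≡ z′ (#3+ a)
    tail≡ a = leaf-injective (map-cong-∈⁻ (allFin ℓ′) (proj₂ codes) (∈-allFin a))

    bucket≡ : bucket c B (z #1) ≡ bucket c B (z′ #1)
    bucket≡ = ℤP.+-injective (leaf-injective (proj₁ codes))

    S : (Fin ℓ → ℤ) → Bool → ℤ
    S w b = coeff c b #0 ℤ.* w #0 ℤ.+ (coeff c b #1 ℤ.* w #1 ℤ.+ (coeff c b #2 ℤ.* w #2 ℤ.+ tailSum c z b))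

    S≡ : ∀ b → S z b ≡ S z′ b
    S≡ b = trans (same-forms b) (cong (λ r → coeff c b #0 ℤ.* z′ #0 ℤ.+ (coeff c b #1 ℤ.* z′ #1 ℤ.+ (coeff c b #2 ℤ.* z′ #2 ℤ.+ r)))
      (cong sumℤ (trans (LP.map-tabulate _ _) (trans (LP.tabulate-cong λ a → cong (coeff c b (#3+ a) ℤ.*_) (sym (tail≡ a)))
                                                     (sym (LP.map-tabulate _ _))))))

    key : α c ℤ.* (z #0 ℤ.- z′ #0) ℤ.+ β c ℤ.* (z #1 ℤ.- z′ #1) ≡ + 0
    key = begin
      α c ℤ.* (z #0 ℤ.- z′ #0) ℤ.+ β c ℤ.* (z #1 ℤ.- z′ #1)
        ≡⟨ elimination (c #0) (c #1) (c #2) (z #0) (z #1) (z #2) (z′ #0) (z′ #1) (z′ #2) (tailSum c z false) (tailSum c z true) ⟩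
      (S z true ℤ.- S z′ true) ℤ.- c #2 ℤ.* (S z false ℤ.- S z′ false)
        ≡⟨ cong₂ (λ u v → u ℤ.- c #2 ℤ.* v) (ℤP.i≡j⇒i-j≡0 (S≡ true)) (ℤP.i≡j⇒i-j≡0 (S≡ false)) ⟩
      + 0 ℤ.- c #2 ℤ.* + 0
        ≡⟨ cong (λ v → + 0 ℤ.- v) (ℤP.*-zeroʳ (c #2)) ⟩
      + 0
        ∎
      where open ≡-Reasoning

    z₁≡z₁′ : z #1 ≡ z′ #1
    z₁≡z₁′ = +-cancelʳ (+ B) (z #1) (z′ #1) (trans (sym (+B-nonneg (z #1) B (bz #1)))
               (trans (cong +_ (congruent∧same-quotient⇒≡ (modulus c) ∣ z #1 ℤ.+ + B ∣ ∣ z′ #1 ℤ.+ + B ∣ modulus∣ bucket≡)) (+B-nonneg (z′ #1) B (bz′ #1))))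
      where
      modulus∣ : modulus c ∣ ∣ + ∣ z #1 ℤ.+ + B ∣ ℤ.- + ∣ z′ #1 ℤ.+ + B ∣ ∣
      modulus∣ = subst (λ Δ → modulus c ∣ ∣ Δ ∣)
        (sym (trans (cong₂ ℤ._-_ (+B-nonneg (z #1) B (bz #1)) (+B-nonneg (z′ #1) B (bz′ #1))) (shift-diff (z #1) (z′ #1) (+ B))))
        (modulus∣Δ₁ _ _ key)

    z₀≡z₀′ : z #0 ≡ z′ #0
    z₀≡z₀′ = ℤP.i-j≡0⇒i≡j (z #0) (z′ #0)
      ([ (λ α≡0 → ⊥-elim (∣α∣≢0 (cong ∣_∣ α≡0))) , (λ Δ₀≡0 → Δ₀≡0) ]′ (ℤP.i*j≡0⇒i≡0∨j≡0 (α c) αΔ₀≡0))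
      where
      αΔ₀≡0 : α c ℤ.* (z #0 ℤ.- z′ #0) ≡ + 0
      αΔ₀≡0 = trans (sym (ℤP.+-identityʳ _))
        (trans (cong (λ v → α c ℤ.* (z #0 ℤ.- z′ #0) ℤ.+ v)
                     (sym (trans (cong (β c ℤ.*_) (ℤP.i≡j⇒i-j≡0 z₁≡z₁′)) (ℤP.*-zeroʳ (β c))))) key)

    z₂≡z₂′ : z #2 ≡ z′ #2
    z₂≡z₂′ = ℤP.i-j≡0⇒i≡j (z #2) (z′ #2) (trans (isolate (z′ #0) (z′ #1) (z #2) (z′ #2) (tailSum c z false))
      (ℤP.i≡j⇒i-j≡0 (trans (cong₂ (λ u v → + 1 ℤ.* u ℤ.+ (+ 1 ℤ.* v ℤ.+ (+ 1 ℤ.* z #2 ℤ.+ tailSum c z false)))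
                                   (sym z₀≡z₀′) (sym z₁≡z₁′)) (S≡ false))))

    equal : ∀ a → z a ≡ z′ a
    equal #0      = z₀≡z₀′
    equal #1      = z₁≡z₁′
    equal #2      = z₂≡z₂′
    equal (#3+ a) = tail≡ a

  ppH≤dd*modulus : ∀ {c} → WellSpread c → p * p * H ≤ d * d * modulus c
  ppH≤dd*modulus {c} spread@(pH≤d∣α∣ , pg≤d) = begin
    p * p * H                 ≡⟨ ℕP.*-assoc p p H ⟩
    p * (p * H)               ≤⟨ ℕP.*-monoʳ-≤ p pH≤d∣α∣ ⟩
    p * (d * ∣ α c ∣)         ≡⟨ cong (λ n → p * (d * n)) modulus*g≡∣α∣ ⟨
    p * (d * (modulus c * g)) ≡⟨ regroup p d (modulus c) g ⟩
    d * modulus c * (p * g)   ≤⟨ ℕP.*-monoʳ-≤ (d * modulus c) pg≤d ⟩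
    d * modulus c * d         ≡⟨ *-rightComm d (modulus c) d ⟩
    d * d * modulus c         ∎
    where
    open ℕP.≤-Reasoning
    open Modulus c (WellSpread⇒∣α∣≢0 {c} spread) using (g; modulus*g≡∣α∣)
    regroup : ∀ p d Q g → p * (d * (Q * g)) ≡ d * Q * (p * g)
    regroup = ℕSolver.solve-∀

  WellSpread⇒p≤d : ∀ {c} → WellSpread c → p ≤ d
  WellSpread⇒p≤d {c} spread@(_ , pg≤d) = ℕP.≤-trans (ℕP.m≤m*n p g) pg≤d
    where open Modulus c (WellSpread⇒∣α∣≢0 {c} spread) using (g; g-nonZero)

  buckets-≤ : ∀ {c} B → WellSpread c → H ≤ B → suc (2 * B / modulus c) * (p * p * H) ≤ 3 * (d * d) * B
  buckets-≤ {c} B spread H≤B = begin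
    p * p * H + K * (p * p * H)           ≤⟨ ℕP.+-mono-≤ (ℕP.*-mono-≤ (ℕP.*-mono-≤ p≤d p≤d) H≤B) (ℕP.*-monoʳ-≤ K (ppH≤dd*modulus {c} spread)) ⟩
    d * d * B + K * (d * d * modulus c)   ≡⟨ cong (λ n → d * d * B + n) (*-leftComm K (d * d) (modulus c)) ⟩
    d * d * B + d * d * (K * modulus c)   ≤⟨ ℕP.+-monoʳ-≤ (d * d * B) (ℕP.*-monoʳ-≤ (d * d) (m/n*n≤m (2 * B) (modulus c))) ⟩
    d * d * B + d * d * (2 * B)           ≡⟨ regroup (d * d) B ⟩
    3 * (d * d) * B                       ∎
    where
    open ℕP.≤-Reasoning
    K = 2 * B / modulus c
    p≤d = WellSpread⇒p≤d {c} spread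
    regroup : ∀ D B → D * B + D * (2 * B) ≡ 3 * D * B
    regroup = ℕSolver.solve-∀

  length-pairCodes-≤ : ∀ {c} B → WellSpread c → H ≤ B →
                       length (pairCodes c B) * (p * p * H) ≤ 3 ^ suc ℓ′ * (d * d) * B ^ suc ℓ′
  length-pairCodes-≤ {c} B spread H≤B = begin
    length (pairCodes c B) * (p * p * H)                     ≡⟨ cong (_* (p * p * H)) (length-pairCodes c B) ⟩
    suc (2 * B / modulus c) * suc (2 * B) ^ ℓ′ * (p * p * H) ≡⟨ *-rightComm (suc (2 * B / modulus c)) _ (p * p * H) ⟩
    suc (2 * B / modulus c) * (p * p * H) * suc (2 * B) ^ ℓ′ ≤⟨ ℕP.*-mono-≤ (buckets-≤ {c} B spread H≤B) (ℕP.^-monoˡ-≤ ℓ′ 1+2B≤3B) ⟩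
    3 * (d * d) * B * (3 * B) ^ ℓ′                           ≡⟨ cong (3 * (d * d) * B *_) (^-distribʳ-* 3 B ℓ′) ⟩
    3 * (d * d) * B * (3 ^ ℓ′ * B ^ ℓ′)                      ≡⟨ regroup (d * d) B (3 ^ ℓ′) (B ^ ℓ′) ⟩
    3 ^ suc ℓ′ * (d * d) * B ^ suc ℓ′                        ∎
    where
    open ℕP.≤-Reasoning
    1+2B≤3B = 1+2n≤3n (ℕP.≤-trans (ℕ.>-nonZero⁻¹ H) H≤B)
    regroup : ∀ D B T X → 3 * D * B * (T * X) ≡ 3 * T * D * (B * X)
    regroup = ℕSolver.solve-∀

  Idx : ℕ → Set
  Idx n = Vec (Fin ℓ) n

  Coeffs : ℕ → Set
  Coeffs n = Fin n → Idx n → ℤ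

  indices : ∀ n → List (Idx n)
  indices n = vecs (allFin ℓ) n

  signs : ∀ n → List (Vec Bool n)
  signs n = vecs Bools n

  form : ∀ n → Coeffs n → (Idx n → ℤ) → Vec Bool n → ℤ
  form n G w u = sumℤ (map (λ i → monomial u (λ l → G l i) ℤ.* w i) (indices n))

  sliceCoeffs : ∀ {n} → Coeffs (suc n) → Fin ℓ → Coeffs n
  sliceCoeffs G a l i = G (suc l) (a ∷ i)

  slice : ∀ {n} → (Idx (suc n) → ℤ) → Fin ℓ → Idx n → ℤ
  slice w a i = w (a ∷ i)

  topCoeffs : ∀ {n} → Coeffs (suc n) → Fin ℓ → ℤ
  topCoeffs {n} G a = G zero (a ∷ V.replicate n zero)

  TopDependsOnFirst : ∀ {n} → Coeffs (suc n) → Set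
  TopDependsOnFirst G = ∀ a i → G zero (a ∷ i) ≡ topCoeffs G a

  Structured : ∀ n → Coeffs n → Set
  Structured zero    G = ⊤
  Structured (suc n) G = TopDependsOnFirst G × WellSpread (topCoeffs G) × (∀ a → Structured n (sliceCoeffs G a))

  partialSums : ∀ n → Coeffs (suc n) → (Idx (suc n) → ℤ) → Vec Bool n → Fin ℓ → ℤ
  partialSums n G w u a = form n (sliceCoeffs G a) (slice w a) u

  term-∷ : ∀ {n} {G : Coeffs (suc n)} (w : Idx (suc n) → ℤ) b u a i → TopDependsOnFirst G →
           monomial (b ∷ u) (λ l → G l (a ∷ i)) ℤ.* w (a ∷ i)
           ≡ (if b then topCoeffs G a else + 1) ℤ.* (monomial u (λ l → sliceCoeffs G a l i) ℤ.* slice w a i)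
  term-∷ {G = G} w b u a i top = begin
    monomial (b ∷ u) (λ l → G l (a ∷ i)) ℤ.* w (a ∷ i)
      ≡⟨ cong (ℤ._* w (a ∷ i)) (monomial-∷ b u (λ l → G l (a ∷ i))) ⟩
    (if b then G zero (a ∷ i) else + 1) ℤ.* monomial u (λ l → sliceCoeffs G a l i) ℤ.* w (a ∷ i)
      ≡⟨ cong (λ x → (if b then x else + 1) ℤ.* monomial u (λ l → sliceCoeffs G a l i) ℤ.* w (a ∷ i)) (top a i) ⟩
    (if b then topCoeffs G a else + 1) ℤ.* monomial u (λ l → sliceCoeffs G a l i) ℤ.* w (a ∷ i)
      ≡⟨ ℤP.*-assoc (if b then topCoeffs G a else + 1) _ _ ⟩
    (if b then topCoeffs G a else + 1) ℤ.* (monomial u (λ l → sliceCoeffs G a l i) ℤ.* slice w a i)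
      ∎
    where open ≡-Reasoning

  form-∷ : ∀ n G w b u → TopDependsOnFirst G →
           form (suc n) G w (b ∷ u) ≡ pairForm (topCoeffs G) (partialSums n G w u) b
  form-∷ n G w b u top = begin
    form (suc n) G w (b ∷ u)
      ≡⟨ sumℤ-map-concatMap term (λ a → map (a ∷_) (indices n)) (allFin ℓ) ⟩
    sumℤ (map (λ a → sumℤ (map term (map (a ∷_) (indices n)))) (allFin ℓ))
      ≡⟨ cong sumℤ (LP.map-cong (λ a → trans (cong sumℤ (sym (LP.map-∘ (indices n)))) (slice-sum a)) (allFin ℓ)) ⟩
    pairForm (topCoeffs G) (partialSums n G w u) b
      ∎
    where
    open ≡-Reasoning
    term : Idx (suc n) → ℤ
    term i = monomial (b ∷ u) (λ l → G l i) ℤ.* w i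
    slice-sum : ∀ a → sumℤ (map (term ∘ (a ∷_)) (indices n)) ≡ (if b then topCoeffs G a else + 1) ℤ.* partialSums n G w u a
    slice-sum a = trans (cong sumℤ (LP.map-cong (λ i → term-∷ {G = G} w b u a i top) (indices n)))
      (sumℤ-map-*ˡ (if b then topCoeffs G a else + 1) (λ i → monomial u (λ l → sliceCoeffs G a l i) ℤ.* slice w a i) (indices n))

  InBox : ∀ n → (Idx n → ℤ) → Set
  InBox n w = ∀ i → ∣ w i ∣ ≤ M

  CoeffsBounded : ∀ n → Coeffs n → Set
  CoeffsBounded n G = ∀ l i → ∣ G l i ∣ ≤ H

  partialBound : ∀ n → Vec Bool n → ℕ
  partialBound n u = ℓ ^ n * H ^ trues u * M

  ∣form∣≤ : ∀ n {G w} u → CoeffsBounded n G → InBox n w → ∣ form n G w u ∣ ≤ partialBound n u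
  ∣form∣≤ n {G} {w} u G≤H w≤M =
    subst (∣ form n G w u ∣ ≤_) (trans (cong (_* (H ^ trues u * M)) (length-allVecsFin ℓ n)) (sym (ℕP.*-assoc (ℓ ^ n) _ _)))
      (∣sumℤ-map∣≤ _ (H ^ trues u * M) (indices n) λ i →
        subst (_≤ H ^ trues u * M) (sym (ℤP.abs-* (monomial u (λ l → G l i)) (w i)))
          (ℕP.*-mono-≤ (∣monomial∣≤ u (λ l → G≤H l i)) (w≤M i)))

  code : ∀ n → Coeffs n → (Idx n → ℤ) → Code
  code zero    G w = node []
  code (suc n) G w =
    node (node (map (λ u → pairCode (topCoeffs G) (partialBound n u) (partialSums n G w u)) (signs n))
          ∷ map (λ a → code n (sliceCoeffs G a) (slice w a)) (allFin ℓ))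

  topCodes : ∀ n → Coeffs (suc n) → List (List Code)
  topCodes n G = choices (map (λ u → pairCodes (topCoeffs G) (partialBound n u)) (signs n))

  codes : ∀ n → Coeffs n → List Code
  codes zero    G = node [] ∷ []
  codes (suc n) G = concatMap (λ xs → map (λ ys → node (node xs ∷ ys)) (choices (map (λ a → codes n (sliceCoeffs G a)) (allFin ℓ))))
                              (topCodes n G)

  code∈codes : ∀ n {G w} → CoeffsBounded n G → InBox n w → code n G w ∈ codes n G
  code∈codes zero    _   _   = here refl
  code∈codes (suc n) {G} {w} G≤H w≤M =
    ∈-concatMap⁺′ _ (map∈choices _ _ (signs n) λ {u} _ → pairCode∈pairCodes (topCoeffs G) {partialBound n u} {partialSums n G w u} λ a → ∣form∣≤ n u (slice-bounded a) (λ i → w≤M (a ∷ i)))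
      (∈-map⁺ _ (map∈choices _ _ (allFin ℓ) λ {a} _ → code∈codes n (slice-bounded a) (λ i → w≤M (a ∷ i))))
    where
    slice-bounded : ∀ a → CoeffsBounded n (sliceCoeffs G a)
    slice-bounded a l i = G≤H (suc l) (a ∷ i)

  -- The pair codes fix the partial sums, which are the right-hand sides for the slices.
  code-injective : ∀ n {G w w′} → Structured n G → CoeffsBounded n G → InBox n w → InBox n w′ →
    (∀ u → form n G w u ≡ form n G w′ u) → code n G w ≡ code n G w′ → ∀ i → w i ≡ w′ i
  code-injective zero {w = w} {w′} _ _ _ _ same-forms _ [] =
    trans (sym (1*x+0≡x (w []))) (trans (same-forms []) (1*x+0≡x (w′ [])))
    where
    1*x+0≡x : ∀ x → + 1 ℤ.* x ℤ.+ + 0 ≡ x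
    1*x+0≡x = ℤSolver.solve-∀
  code-injective (suc n) {G} {w} {w′} (top , spread , sliced) G≤H w≤M w′≤M same-forms same-code (a ∷ i) =
    code-injective n (sliced a) slice-bounded (λ i → w≤M (a ∷ i)) (λ i → w′≤M (a ∷ i))
      (λ u → partialSums≡ u a) (map-cong-∈⁻ (allFin ℓ) (proj₂ codes≡) (∈-allFin a)) i
    where
    codes≡ = LP.∷-injective (node-injective same-code)
    slice-bounded : ∀ {a} → CoeffsBounded n (sliceCoeffs G a)
    slice-bounded {a} l i = G≤H (suc l) (a ∷ i)
    partialSums≡ : ∀ u a → partialSums n G w u a ≡ partialSums n G w′ u a
    partialSums≡ u = pairCode-injective {topCoeffs G} {partialBound n u} {partialSums n G w u} {partialSums n G w′ u} spread
      (λ a → ∣form∣≤ n u slice-bounded (λ i → w≤M (a ∷ i)))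
      (λ a → ∣form∣≤ n u slice-bounded (λ i → w′≤M (a ∷ i)))
      (λ b → trans (sym (form-∷ n G w b u top)) (trans (same-forms (b ∷ u)) (form-∷ n G w′ b u top)))
      (map-cong-∈⁻ (signs n) (node-injective (proj₁ codes≡)) (∈-vecs u ∈-Bools))

  levelConstant : ℕ → ℕ
  levelConstant n = 3 ^ suc ℓ′ * (ℓ ^ n) ^ suc ℓ′ * (d * d) * M ^ suc ℓ′

  length-pairCodes-partial-≤ : ∀ n {c} u → WellSpread c → H ≤ M →
    length (pairCodes c (partialBound n u)) * (p * p * H) ≤ levelConstant n * H ^ (trues u * suc ℓ′)
  length-pairCodes-partial-≤ n {c} u spread H≤M = begin
    length (pairCodes c B) * (p * p * H)
      ≤⟨ length-pairCodes-≤ {c} B spread H≤B ⟩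
    3 ^ suc ℓ′ * (d * d) * B ^ suc ℓ′
      ≡⟨ cong (3 ^ suc ℓ′ * (d * d) *_) (trans (^-distribʳ-*³ (ℓ ^ n) (H ^ trues u) M (suc ℓ′))
           (cong (λ x → (ℓ ^ n) ^ suc ℓ′ * x * M ^ suc ℓ′) (ℕP.^-*-assoc H (trues u) (suc ℓ′)))) ⟩
    3 ^ suc ℓ′ * (d * d) * ((ℓ ^ n) ^ suc ℓ′ * H ^ (trues u * suc ℓ′) * M ^ suc ℓ′)
      ≡⟨ regroup (3 ^ suc ℓ′) (d * d) ((ℓ ^ n) ^ suc ℓ′) (H ^ (trues u * suc ℓ′)) (M ^ suc ℓ′) ⟩
    levelConstant n * H ^ (trues u * suc ℓ′)
      ∎
    where
    open ℕP.≤-Reasoning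
    B = partialBound n u
    regroup : ∀ t D L h m → t * D * (L * h * m) ≡ t * L * D * m * h
    regroup = ℕSolver.solve-∀
    H≤B : H ≤ B
    H≤B = ℕP.≤-trans H≤M (ℕP.m≤n*m M (ℓ ^ n * H ^ trues u) {{ℕP.m*n≢0 _ _ {{ℕP.m^n≢0 ℓ n}} {{ℕP.m^n≢0 H (trues u)}}}})

  length-topCodes-≤ : ∀ n {G} → WellSpread (topCoeffs G) → H ≤ M →
    length (topCodes n G) * (p * p * H) ^ 2 ^ n ≤ levelConstant n ^ 2 ^ n * H ^ (hExponent n * suc ℓ′)
  length-topCodes-≤ n {G} spread H≤M = begin
    length (topCodes n G) * (p * p * H) ^ 2 ^ n
      ≡⟨ cong₂ (λ L k → L * (p * p * H) ^ k) (length-choices (λ u → pairCodes (topCoeffs G) (partialBound n u)) (signs n)) (sym (length-vecs Bools n)) ⟩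
    product (map (λ u → length (pairCodes (topCoeffs G) (partialBound n u))) (signs n)) * (p * p * H) ^ length (signs n)
      ≤⟨ product-map-≤-* _ (λ u → levelConstant n * H ^ (trues u * suc ℓ′)) (p * p * H) (signs n)
           (λ {u} _ → length-pairCodes-partial-≤ n {topCoeffs G} u spread H≤M) ⟩
    product (map (λ u → levelConstant n * H ^ (trues u * suc ℓ′)) (signs n))
      ≡⟨ product-map-* (λ _ → levelConstant n) (λ u → H ^ (trues u * suc ℓ′)) (signs n) ⟩
    product (map (λ _ → levelConstant n) (signs n)) * product (map (λ u → H ^ (trues u * suc ℓ′)) (signs n))
      ≡⟨ cong₂ _*_ (trans (product-map-const _ (signs n)) (cong (levelConstant n ^_) (length-vecs Bools n)))
           (trans (product-map-^ H (λ u → trues u * suc ℓ′) (signs n))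
             (cong (H ^_) (trans (sum-map-*ʳ (suc ℓ′) trues (signs n)) (cong (_* suc ℓ′) (sum-trues n))))) ⟩
    levelConstant n ^ 2 ^ n * H ^ (hExponent n * suc ℓ′)
      ∎
    where open ℕP.≤-Reasoning

  weight volume : ℕ → ℕ
  weight n = p ^ ηExponent ℓ n * M ^ 2 ^ n * H ^ hExponent n
  volume n = codeConstant ℓ′ n * d ^ ηExponent ℓ n * suc (2 * M) ^ ℓ ^ n

  length-codes-suc : ∀ n G → length (codes (suc n) G)
                     ≡ length (topCodes n G) * product (map (λ a → length (codes n (sliceCoeffs G a))) (allFin ℓ))
  length-codes-suc n G =
    trans (length-concatMap-const _ _ (topCodes n G) λ xs → LP.length-map (λ ys → node (node xs ∷ ys)) sliceCodes)
          (cong (length (topCodes n G) *_) (length-choices (λ a → codes n (sliceCoeffs G a)) (allFin ℓ)))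
    where sliceCodes = choices (map (λ a → codes n (sliceCoeffs G a)) (allFin ℓ))

  length-codes-≤ : ∀ n {G} → Structured n G → H ≤ M → length (codes n G) * weight n ≤ volume n
  length-codes-≤ zero    _ _ = subst₂ _≤_ (sym (base-weight M)) (sym (base-volume M)) (ℕP.≤-trans (ℕP.m≤m+n M (M + 0)) (ℕP.n≤1+n _))
    where
    base-weight : ∀ M → 1 * (1 * (M * 1) * 1) ≡ M
    base-weight = ℕSolver.solve-∀
    base-volume : ∀ M → 1 * 1 * (suc (2 * M) * 1) ≡ suc (2 * M)
    base-volume = ℕSolver.solve-∀
  length-codes-≤ (suc n) {G} (_ , spread , sliced) H≤M =
    subst (_≤ volume (suc n)) (cong (_* weight (suc n)) (sym (length-codes-suc n G)))
      (combine-bounds {length (topCodes n G)} {product (map (λ a → length (codes n (sliceCoeffs G a))) (allFin ℓ))}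
                      {(p * p * H) ^ N} {levelConstant n ^ N * H ^ (S * suc ℓ′)} {weight n ^ ℓ} {volume n ^ ℓ}
                      {weight (suc n)} {volume (suc n)} {M ^ (N * suc ℓ′) * H ^ (S * suc ℓ′)}
                      (length-topCodes-≤ n {G} spread H≤M) slices-≤
        (trans (weight-step ℓ′ p M H N S E) (cong (λ k → p ^ (N + N + E * ℓ) * M ^ (2 * N) * H ^ k * (M ^ (N * suc ℓ′) * H ^ (S * suc ℓ′))) (sym (hExponent-suc n))))
        (trans (volume-step ℓ′ (3 ^ suc ℓ′ * (ℓ ^ n) ^ suc ℓ′) d M H N S (codeConstant ℓ′ n) (suc (2 * M)) (ℓ ^ n) E)
               (cong (λ k → codeConstant ℓ′ (suc n) * d ^ (N + N + E * ℓ) * suc (2 * M) ^ k * (M ^ (N * suc ℓ′) * H ^ (S * suc ℓ′)))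
                     (ℕP.*-comm (ℓ ^ n) ℓ))))
    where
    N = 2 ^ n
    S = hExponent n
    E = ηExponent ℓ n
    instance
      M-nonZero : NonZero M
      M-nonZero = ℕ.>-nonZero (ℕP.≤-trans (ℕ.>-nonZero⁻¹ H) H≤M)
      R-nonZero : NonZero (M ^ (N * suc ℓ′) * H ^ (S * suc ℓ′))
      R-nonZero = ℕP.m*n≢0 (M ^ (N * suc ℓ′)) (H ^ (S * suc ℓ′)) {{ℕP.m^n≢0 M (N * suc ℓ′)}} {{ℕP.m^n≢0 H (S * suc ℓ′)}}
    slices-≤ : product (map (λ a → length (codes n (sliceCoeffs G a))) (allFin ℓ)) * weight n ^ ℓ ≤ volume n ^ ℓ
    slices-≤ = subst₂ (λ k v → product (map (λ a → length (codes n (sliceCoeffs G a))) (allFin ℓ)) * weight n ^ k ≤ v)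
      (length-allFin ℓ) (trans (product-map-const (volume n) (allFin ℓ)) (cong (volume n ^_) (length-allFin ℓ)))
      (product-map-≤-* (λ a → length (codes n (sliceCoeffs G a))) (λ _ → volume n) (weight n) (allFin ℓ)
         λ {a} _ → length-codes-≤ n (sliced a) H≤M)

  DependsOnPrefix : ∀ n → Coeffs n → Set
  DependsOnPrefix n G = ∀ l i i′ → (∀ q → toℕ q ≤ toℕ l → lookup i q ≡ lookup i′ q) → G l i ≡ G l i′

  LinesWellSpread : ∀ n → Coeffs n → Set
  LinesWellSpread n G = ∀ l i → WellSpread (λ a → G l (i [ l ]≔ a))

  structured : ∀ n {G} → DependsOnPrefix n G → LinesWellSpread n G → Structured n G
  structured zero    _      _     = tt
  structured (suc n) {G} prefix lines = top , lines zero (zero ∷ V.replicate n zero) , λ a →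
    structured n (λ l i i′ same → prefix (suc l) (a ∷ i) (a ∷ i′) λ { zero _ → refl ; (suc q) (s≤s q≤l) → same q q≤l })
                 (λ l i → lines (suc l) (a ∷ i))
    where
    top : TopDependsOnFirst G
    top a i = prefix zero (a ∷ i) (a ∷ V.replicate n zero) λ { zero _ → refl ; (suc _) () }

andAll⇒ : {A : Set} {xs : List A} {p : A → Bool} → T (andAll xs p) → ∀ {x} → x ∈ xs → T (p x)
andAll⇒ {xs = _ ∷ _} all (here refl) = proj₁ (Equivalence.to T-∧ all)
andAll⇒ {xs = _ ∷ _} all (there x∈) = andAll⇒ (proj₂ (Equivalence.to T-∧ all)) x∈

T-does⇒ : ∀ {P : Set} (P? : Dec P) → T (does P?) → P
T-does⇒ (yes p) _ = p

T-not-does : ∀ {P : Set} (P? : Dec P) → ¬ P → T (not (does P?))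
T-not-does (yes p) ¬p = ⊥-elim (¬p p)
T-not-does (no _)  _  = tt

if-T : ∀ {c x} → T c → T (if c then x else true) → T x
if-T {true} _ t = t

increasing⇒distinct : ∀ {t m} (row : Vec (Fin t) (suc (suc (suc m)))) → T (strictlyIncreasing row) →
  lookup row zero ≢ lookup row (suc zero) × lookup row (suc zero) ≢ lookup row (suc (suc zero))
  × lookup row zero ≢ lookup row (suc (suc zero))
increasing⇒distinct (x ∷ y ∷ z ∷ _) increasing =
  FP.<⇒≢ x<y , FP.<⇒≢ y<z , FP.<⇒≢ (FP.<-trans x<y y<z)
  where
  x<y∧rest = Equivalence.to (T-∧ {does (x F.<? y)}) increasing
  x<y = T-does⇒ (x F.<? y) (proj₁ x<y∧rest)
  y<z = T-does⇒ (y F.<? z) (proj₁ (Equivalence.to (T-∧ {does (y F.<? z)}) (proj₂ x<y∧rest)))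

module HCoefficients (ℓ′ t r p₀ d₀ : ℕ) (coprime : Coprime (suc p₀) (suc d₀)) (H M : ℕ) .{{_ : NonZero H}} where

  η : ℚ
  η = mkℚ +[1+ p₀ ] d₀ coprime

  open Encoding ℓ′ (suc p₀) (suc d₀) H M public

  η≃ : η ≃ suc p₀ ∕ suc d₀
  η≃ = fraction ℚᵘP.≃-refl

  1/η≃ : 1/ η ≃ suc d₀ ∕ suc p₀
  1/η≃ = fraction ℚᵘP.≃-refl

  ηH≤ᵇ⇒ : ∀ x → T ((η ℚ.* ℕtoℚ H) ℚ.≤ᵇ ℤtoℚ (+ x)) → suc p₀ * H ≤ suc d₀ * x
  ηH≤ᵇ⇒ x le = subst₂ _≤_ (ℕP.*-identityʳ (suc p₀ * H)) (ℕP.*-comm x (suc d₀))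
    (≃-≤⁻ (≃-*ℕ η≃ H) (ℕtoℚ-≃ x) (ℚP.≤ᵇ⇒≤ le))

  ≤ᵇ1/η⇒ : ∀ g → T (ℕtoℚ g ℚ.≤ᵇ 1/ η) → suc p₀ * g ≤ suc d₀
  ≤ᵇ1/η⇒ g le = subst₂ _≤_ (ℕP.*-comm g (suc p₀)) (ℕP.*-identityʳ (suc d₀)) (≃-≤⁻ (ℕtoℚ-≃ g) 1/η≃ (ℚP.≤ᵇ⇒≤ le))

  hCoeffs : (HIdx t r → ℤ) → Kidx t ℓ r → Coeffs r
  hCoeffs h k l i = h (l , ktuple l k i)

  hCoeffs-dependsOnPrefix : ∀ h k → DependsOnPrefix r (hCoeffs h k)
  hCoeffs-dependsOnPrefix h k l i i′ same = cong (λ v → h (l , v)) (VP.tabulate-cong λ q →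
    cong (lookup (lookup k (inject≤ q (FP.toℕ<n l))))
         (same (inject≤ q (FP.toℕ<n l)) (subst (_≤ toℕ l) (sym (FP.toℕ-inject≤ q (FP.toℕ<n l))) (FP.toℕ≤pred[n] q))))

  private
    ktuple-last : ∀ (l : Fin r) (k : Kidx t ℓ r) (i : Vec (Fin ℓ) r) a → lookup (ktuple l k (i [ l ]≔ a)) (F.fromℕ (toℕ l)) ≡ lookup (lookup k l) a
    ktuple-last l k i a = begin
      lookup (ktuple l k (i [ l ]≔ a)) (F.fromℕ (toℕ l))
        ≡⟨ VP.lookup∘tabulate (λ q → lookup (lookup k (inject≤ q (FP.toℕ<n l))) (lookup (i [ l ]≔ a) (inject≤ q (FP.toℕ<n l))))
                              (F.fromℕ (toℕ l)) ⟩
      lookup (lookup k l′) (lookup (i [ l ]≔ a) l′)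
        ≡⟨ cong (λ q → lookup (lookup k q) (lookup (i [ l ]≔ a) q)) l′≡l ⟩
      lookup (lookup k l) (lookup (i [ l ]≔ a) l)
        ≡⟨ cong (lookup (lookup k l)) (VP.lookup∘update l i a) ⟩
      lookup (lookup k l) a
        ∎
      where
      open ≡-Reasoning
      l′ = inject≤ (F.fromℕ (toℕ l)) (FP.toℕ<n l)
      l′≡l : l′ ≡ l
      l′≡l = FP.toℕ-injective (trans (FP.toℕ-inject≤ (F.fromℕ (toℕ l)) (FP.toℕ<n l)) (FP.toℕ-fromℕ (toℕ l)))

  -- The three tuples of a line end in the distinct entries k_{l0} < k_{l1} < k_{l2} of row l,
  -- so the defining inequalities of 𝓗_l apply to them.
  hCoeffs-linesWellSpread : ∀ h k → k ∈ 𝒦 t ℓ r → (∀ l → T (in𝓗 η H t r l h)) → LinesWellSpread r (hCoeffs h k)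
  hCoeffs-linesWellSpread h k k∈𝒦 h∈𝓗 l i =
    ηH≤ᵇ⇒ _ (proj₁ (Equivalence.to T-∧ bounds)) , ≤ᵇ1/η⇒ _ (proj₂ (Equivalence.to T-∧ bounds))
    where
    tuple : Fin ℓ → Vec (Fin t) (suc (toℕ l))
    tuple a = ktuple l k (i [ l ]≔ a)
    increasing : T (strictlyIncreasing (lookup k l))
    increasing = andAll⇒ (proj₂ (∈-filter⁻ (T? ∘ λ k → andAll (V.toList k) strictlyIncreasing) {xs = vecs (vecs (allFin t) ℓ) r} k∈𝒦))
                         (∈-toList⁺ (∈-lookupᵛ l k))
    distinct : ∀ {a b} → lookup (lookup k l) a ≢ lookup (lookup k l) b → tuple a ≢ tuple b
    distinct {a} {b} entries≢ eq = entries≢ (trans (sym (ktuple-last l k i a)) (trans (cong (λ (v : Vec (Fin t) (suc (toℕ l))) → lookup v (F.fromℕ (toℕ l))) eq) (ktuple-last l k i b)))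
    row-distinct = increasing⇒distinct (lookup k l) increasing
    ∈tuples : ∀ a → tuple a ∈ vecs (allFin t) (suc (toℕ l))
    ∈tuples a = ∈-allVecsFin (tuple a)
    differ : Fin ℓ → Fin ℓ → Bool
    differ a b = not (does (VP.≡-dec F._≟_ (tuple a) (tuple b)))
    pairwise-differ : T (differ #0 #1 ∧ differ #1 #2 ∧ differ #0 #2)
    pairwise-differ = Equivalence.from (T-∧ {differ #0 #1}) (differ⁺ (distinct (proj₁ row-distinct))
                    , Equivalence.from (T-∧ {differ #1 #2}) (differ⁺ (distinct (proj₁ (proj₂ row-distinct)))
                                                          , differ⁺ (distinct (proj₂ (proj₂ row-distinct)))))
      where
      differ⁺ : ∀ {a b} → tuple a ≢ tuple b → T (differ a b)
      differ⁺ {a} {b} = T-not-does (VP.≡-dec F._≟_ (tuple a) (tuple b))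
    bounds = if-T {differ #0 #1 ∧ differ #1 #2 ∧ differ #0 #2} pairwise-differ
               (andAll⇒ (andAll⇒ (andAll⇒ (h∈𝓗 l) (∈tuples #0)) (∈tuples #1)) (∈tuples #2))

  hCoeffs-structured : ∀ h k → k ∈ 𝒦 t ℓ r → (∀ l → T (in𝓗 η H t r l h)) → Structured r (hCoeffs h k)
  hCoeffs-structured h k k∈𝒦 h∈𝓗 = structured r (hCoeffs-dependsOnPrefix h k) (hCoeffs-linesWellSpread h k k∈𝒦 h∈𝓗)

unique-𝒦 : ∀ t ℓ r → Unique (𝒦 t ℓ r)
unique-𝒦 t ℓ r = UniqueP.filter⁺ (T? ∘ λ k → andAll (V.toList k) strictlyIncreasing)
                   (unique-vecs r (unique-vecs ℓ (UniqueP.allFin⁺ t)))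

module _ (s t ℓ r : ℕ) where

  private
    pointsOf : Fin s → Kidx t ℓ r → List (MIdx s t ℓ r)
    pointsOf j k = map (λ i → j , k , i) (vecs (allFin ℓ) r)

    pointsWith : Fin s → List (MIdx s t ℓ r)
    pointsWith j = concatMap (pointsOf j) (𝒦 t ℓ r)

  ∈-mPoints⁻ : ∀ {x} → x ∈ mPoints s t ℓ r → ∃ λ j → ∃ λ k → k ∈ 𝒦 t ℓ r × ∃ λ i → x ≡ (j , k , i)
  ∈-mPoints⁻ x∈ with ∈-concatMap⁻′ pointsWith (allFin s) x∈
  ... | j , _ , x∈j with ∈-concatMap⁻′ (pointsOf j) (𝒦 t ℓ r) x∈j
  ... | k , k∈ , x∈jk with ∈-map⁻ _ x∈jk
  ... | i , _ , x≡ = j , k , k∈ , i , x≡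

  unique-mPoints : Unique (mPoints s t ℓ r)
  unique-mPoints = allPairs-concatMap pointsWith (allFin s) (UniqueP.allFin⁺ s)
    (λ j → allPairs-concatMap (pointsOf j) (𝒦 t ℓ r) (unique-𝒦 t ℓ r)
             (λ k → UniqueP.map⁺ (,-injectiveʳ ∘ ,-injectiveʳ) (unique-vecs r (UniqueP.allFin⁺ ℓ)))
             λ k≢k′ a∈ b∈ a≡b → case ∈-map⁻ _ a∈ , ∈-map⁻ _ b∈ of λ where
               ((_ , _ , refl) , (_ , _ , refl)) → k≢k′ (,-injectiveˡ (,-injectiveʳ a≡b)))
    λ j≢j′ a∈ b∈ a≡b → j≢j′ (trans (sym (first a∈)) (trans (cong proj₁ a≡b) (first b∈)))
    where
    first : ∀ {j x} → x ∈ pointsWith j → proj₁ x ≡ j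
    first x∈ with ∈-concatMap⁻′ (pointsOf _) (𝒦 t ℓ r) x∈
    ... | _ , _ , x∈jk with ∈-map⁻ _ x∈jk
    ... | _ , _ , refl = refl

module Counting (ℓ′ t r s p₀ d₀ : ℕ) (coprime : Coprime (suc p₀) (suc d₀)) (H M : ℕ) .{{_ : NonZero H}}
                (n : Fin s → Kidx t (suc (suc (suc ℓ′))) r → Vec Bool r → ℤ) where

  open HCoefficients ℓ′ t r p₀ d₀ coprime H M public

  mAssignments : List (MIdx s t ℓ r → ℤ)
  mAssignments = assignments _≟M_ (mPoints s t ℓ r) (box M)

  hAssignments : List (HIdx t r → ℤ)
  hAssignments = assignments _≟H_ (hPoints t r) (box H)

  inH : (HIdx t r → ℤ) → Bool
  inH h = andAll (allFin r) (λ l → in𝓗 η H t r l h)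

  solves : (HIdx t r → ℤ) → (MIdx s t ℓ r → ℤ) → Bool
  solves h m = andAll (allFin s) λ j → andAll (𝒦 t ℓ r) λ k → andAll (vecs Bools r) λ u →
    does (linForm h m j k u ℤ.≟ n j k u)

  blocks : List (Fin s × Kidx t ℓ r)
  blocks = concatMap (λ j → map (j ,_) (𝒦 t ℓ r)) (allFin s)

  mBlock : (MIdx s t ℓ r → ℤ) → Fin s × Kidx t ℓ r → Idx r → ℤ
  mBlock m (j , k) i = m (j , k , i)

  encode : (HIdx t r → ℤ) → (MIdx s t ℓ r → ℤ) → Code
  encode h m = node (map (λ jk → code r (hCoeffs h (proj₂ jk)) (mBlock m jk)) blocks)

  encodings : (HIdx t r → ℤ) → List Code
  encodings h = map node (choices (map (λ jk → codes r (hCoeffs h (proj₂ jk))) blocks))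

  ∈-blocks⁺ : ∀ j {k} → k ∈ 𝒦 t ℓ r → (j , k) ∈ blocks
  ∈-blocks⁺ j k∈ = ∈-concatMap⁺′ _ (∈-allFin j) (∈-map⁺ (j ,_) k∈)

  ∈-blocks⁻ : ∀ {jk} → jk ∈ blocks → proj₂ jk ∈ 𝒦 t ℓ r
  ∈-blocks⁻ jk∈ with ∈-concatMap⁻′ (λ j → map (j ,_) (𝒦 t ℓ r)) (allFin s) jk∈
  ... | j , _ , jk∈j with ∈-map⁻ (j ,_) jk∈j
  ... | _ , k∈ , refl = k∈

  inH⇒ : ∀ h → T (inH h) → ∀ l → T (in𝓗 η H t r l h)
  inH⇒ h h∈ l = andAll⇒ {xs = allFin r} {p = λ l → in𝓗 η H t r l h} h∈ (∈-allFin l)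

  solves⇒ : ∀ h m → T (solves h m) → ∀ j {k} → k ∈ 𝒦 t ℓ r → ∀ u → form r (hCoeffs h k) (mBlock m (j , k)) u ≡ n j k u
  solves⇒ h m sol j {k} k∈ u = T-does⇒ (linForm h m j k u ℤ.≟ n j k u) (andAll⇒ (andAll⇒ (andAll⇒ sol (∈-allFin j)) k∈) (∈-vecs u ∈-Bools))

  hCoeffs-bounded : ∀ h → h ∈ hAssignments → ∀ k → CoeffsBounded r (hCoeffs h k)
  hCoeffs-bounded h h∈ k l i = assignment-bounded _≟H_ (hPoints t r) h∈ (l , ktuple l k i)

  mBlock-inBox : ∀ m → m ∈ mAssignments → ∀ jk → InBox r (mBlock m jk)
  mBlock-inBox m m∈ (j , k) i = assignment-bounded _≟M_ (mPoints s t ℓ r) m∈ (j , k , i)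

  encode-injective : ∀ {h x y} → h ∈ hAssignments → T (inH h) → x ∈ mAssignments → y ∈ mAssignments →
    T (solves h x) → T (solves h y) → encode h x ≡ encode h y → ∀ j {k} → k ∈ 𝒦 t ℓ r → ∀ i → x (j , k , i) ≡ y (j , k , i)
  encode-injective {h} {x} {y} h∈ h∈𝓗 x∈ y∈ sx sy same j {k} k∈ =
    code-injective r {hCoeffs h k} {mBlock x (j , k)} {mBlock y (j , k)}
      (hCoeffs-structured h k k∈ (inH⇒ h h∈𝓗)) (hCoeffs-bounded h h∈ k)
      (mBlock-inBox x x∈ (j , k)) (mBlock-inBox y y∈ (j , k))
      (λ u → trans (solves⇒ h x sx j k∈ u) (sym (solves⇒ h y sy j k∈ u)))
      (map-cong-∈⁻ blocks (node-injective same) (∈-blocks⁺ j k∈))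

  count-solves-≤ : ∀ {h} → h ∈ hAssignments → T (inH h) → count (solves h) mAssignments ≤ length (encodings h)
  count-solves-≤ {h} h∈ h∈𝓗 =
    count-≤-by-encoding (solves h) mAssignments
      (assignments-separated _≟M_ (mPoints s t ℓ r) (box M) (unique-mPoints s t ℓ r) (unique-box M))
      (encode h) (encodings h)
      (λ {m} m∈ _ → ∈-map⁺ node (map∈choices (λ jk → code r (hCoeffs h (proj₂ jk)) (mBlock m jk)) (λ jk → codes r (hCoeffs h (proj₂ jk))) blocks
                      λ {jk} _ → code∈codes r (hCoeffs-bounded h h∈ (proj₂ jk)) (mBlock-inBox m m∈ jk)))
      (λ {x} {y} x∈ y∈ sx sy same {pt} pt∈ →
        let j , k , k∈ , i , pt≡ = ∈-mPoints⁻ s t ℓ r pt∈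
        in subst (λ q → x q ≡ y q) (sym pt≡) (encode-injective h∈ h∈𝓗 x∈ y∈ sx sy same j k∈ i))

  length-encodings-≤ : ∀ {h} → T (inH h) → H ≤ M →
                       length (encodings h) * weight r ^ length blocks ≤ volume r ^ length blocks
  length-encodings-≤ {h} h∈𝓗 H≤M =
    subst₂ (λ L V → L * weight r ^ length blocks ≤ V)
      (sym (trans (LP.length-map node (choices (map (λ jk → codes r (hCoeffs h (proj₂ jk))) blocks)))
                  (length-choices (λ jk → codes r (hCoeffs h (proj₂ jk))) blocks)))
      (product-map-const (volume r) blocks)
      (product-map-≤-* (λ jk → length (codes r (hCoeffs h (proj₂ jk)))) (λ _ → volume r) (weight r) blocks
        λ {jk} jk∈ → length-codes-≤ r (hCoeffs-structured h (proj₂ jk) (∈-blocks⁻ jk∈) (inH⇒ h h∈𝓗)) H≤M)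

  total : ℕ
  total = sum (map (λ m → count (λ h → inH h ∧ solves h m) hAssignments) mAssignments)

  private
    count-∧ : ∀ {W V} b (p : (MIdx s t ℓ r → ℤ) → Bool) → (T b → count p mAssignments * W ≤ V) →
              count (λ m → b ∧ p m) mAssignments * W ≤ V
    count-∧ true  p bound = bound tt
    count-∧ false p _     = subst (λ c → c * _ ≤ _) (sym (count-false mAssignments)) z≤n

  total-≤ : H ≤ M → total * weight r ^ length blocks ≤ length hAssignments * volume r ^ length blocks
  total-≤ H≤M =
    subst (λ c → c * W ≤ length hAssignments * V) (sym (sum-count-comm (λ m h → inH h ∧ solves h m) mAssignments hAssignments))
      (sum-map-≤-* (λ h → count (λ m → inH h ∧ solves h m) mAssignments) W V hAssignments λ {h} h∈ → count-∧ (inH h) (solves h) λ h∈𝓗 →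
        ℕP.≤-trans (ℕP.*-monoˡ-≤ W (count-solves-≤ {h} h∈ h∈𝓗)) (length-encodings-≤ {h} h∈𝓗 H≤M))
    where
    W = weight r ^ length blocks
    V = volume r ^ length blocks

  length-assignments-box : ∀ {D : Set} (_≟_ : DecidableEquality D) ds B →
                           length (assignments _≟_ ds (box B)) ≡ suc (2 * B) ^ length ds
  length-assignments-box _≟_ ds B = trans (length-assignments _≟_ ds (box B)) (cong (_^ length ds) (length-box B))

  instance
    hAssignments-nonZero : NonZero (length hAssignments)
    hAssignments-nonZero = subst NonZero (sym (length-assignments-box _≟H_ (hPoints t r) H)) (ℕP.m^n≢0 (suc (2 * H)) (length (hPoints t r)))
    mAssignments-nonZero : NonZero (length mAssignments)
    mAssignments-nonZero = subst NonZero (sym (length-assignments-box _≟M_ (mPoints s t ℓ r) M)) (ℕP.m^n≢0 (suc (2 * M)) (length (mPoints s t ℓ r)))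

  probability≡ : probability ℓ r s t η H M n
                 ≡ ℕtoℚ total ℚ.* (+ 1 ℚ./ length hAssignments) ℚ.* (+ 1 ℚ./ length mAssignments)
  probability≡ = begin
    divℕ (sumℚ (map (λ m → 𝔼 hAssignments (λ h → 𝟏 (inH h) ℚ.* 𝟏 (solves h m))) mAssignments)) (length mAssignments)
      ≡⟨ divℕ≡ _ (length mAssignments) ⟩
    sumℚ (map (λ m → 𝔼 hAssignments (λ h → 𝟏 (inH h) ℚ.* 𝟏 (solves h m))) mAssignments) ℚ.* 1/|mA|
      ≡⟨ cong (ℚ._* 1/|mA|) (trans (cong sumℚ (LP.map-cong inner mAssignments)) (sumℚ-map-*ʳ (ℕtoℚ ∘ count-h) 1/|hA| mAssignments)) ⟩
    sumℚ (map (ℕtoℚ ∘ count-h) mAssignments) ℚ.* 1/|hA| ℚ.* 1/|mA|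
      ≡⟨ cong (λ q → q ℚ.* 1/|hA| ℚ.* 1/|mA|) (sumℚ-map-ℕtoℚ count-h mAssignments) ⟩
    ℕtoℚ total ℚ.* 1/|hA| ℚ.* 1/|mA|
      ∎
    where
    open ≡-Reasoning
    1/|hA| = + 1 ℚ./ length hAssignments
    1/|mA| = + 1 ℚ./ length mAssignments
    count-h : (MIdx s t ℓ r → ℤ) → ℕ
    count-h m = count (λ h → inH h ∧ solves h m) hAssignments
    inner : ∀ m → 𝔼 hAssignments (λ h → 𝟏 (inH h) ℚ.* 𝟏 (solves h m)) ≡ ℕtoℚ (count-h m) ℚ.* 1/|hA|
    inner m = trans (divℕ≡ _ (length hAssignments)) (cong (ℚ._* 1/|hA|) (begin
      sumℚ (map (λ h → 𝟏 (inH h) ℚ.* 𝟏 (solves h m)) hAssignments)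
        ≡⟨ cong sumℚ (LP.map-cong (λ h → 𝟏*𝟏≡ℕtoℚ-indicator (inH h) (solves h m)) hAssignments) ⟩
      sumℚ (map (λ h → ℕtoℚ (indicator (inH h ∧ solves h m))) hAssignments)
        ≡⟨ sumℚ-map-ℕtoℚ (λ h → indicator (inH h ∧ solves h m)) hAssignments ⟩
      ℕtoℚ (sum (map (λ h → indicator (inH h ∧ solves h m)) hAssignments))
        ≡⟨ cong ℕtoℚ (count≡sum-indicator (λ h → inH h ∧ solves h m) hAssignments) ⟨
      ℕtoℚ (count-h m)
        ∎))

  private
    K = length (𝒦 t ℓ r)

    length-blocks : length blocks ≡ s * K
    length-blocks = trans (length-concatMap-const _ K (allFin s) λ j → LP.length-map (j ,_) (𝒦 t ℓ r))
                          (cong (_* K) (length-allFin s))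

    length-mPoints : length (mPoints s t ℓ r) ≡ s * (K * ℓ ^ r)
    length-mPoints = trans (length-concatMap-const _ (K * ℓ ^ r) (allFin s) λ j →
        length-concatMap-const _ (ℓ ^ r) (𝒦 t ℓ r) λ k → trans (LP.length-map _ (vecs (allFin ℓ) r)) (length-allVecsFin ℓ r))
      (cong (_* (K * ℓ ^ r)) (length-allFin s))

  C C′ : ℕ
  C  = codeConstant ℓ′ r ^ (s * K)
  C′ = ηExponent ℓ r * (s * K)

  weight-total : weight r ^ length blocks ≡ suc p₀ ^ C′ * M ^ (2 ^ r * s * K) * H ^ (r * 2 ^ (r ∸ 1) * s * K)
  weight-total = trans (^-distribʳ-*³ (suc p₀ ^ ηExponent ℓ r) (M ^ 2 ^ r) (H ^ hExponent r) (length blocks)) (cong₃ (λ x y z → x * y * z)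
    (trans (ℕP.^-*-assoc (suc p₀) (ηExponent ℓ r) (length blocks)) (cong (λ k → suc p₀ ^ (ηExponent ℓ r * k)) length-blocks))
    (trans (ℕP.^-*-assoc M (2 ^ r) (length blocks)) (cong (M ^_) (trans (cong (2 ^ r *_) length-blocks) (sym (ℕP.*-assoc (2 ^ r) s K)))))
    (trans (ℕP.^-*-assoc H (hExponent r) (length blocks))
           (cong (H ^_) (trans (cong (hExponent r *_) length-blocks) (sym (ℕP.*-assoc (hExponent r) s K))))))

  volume-total : volume r ^ length blocks ≡ C * suc d₀ ^ C′ * length mAssignments
  volume-total = trans (^-distribʳ-*³ (codeConstant ℓ′ r) (suc d₀ ^ ηExponent ℓ r) (suc (2 * M) ^ ℓ ^ r) (length blocks))
    (cong₃ (λ x y z → x * y * z)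
      (cong (codeConstant ℓ′ r ^_) length-blocks)
      (trans (ℕP.^-*-assoc (suc d₀) (ηExponent ℓ r) (length blocks)) (cong (λ k → suc d₀ ^ (ηExponent ℓ r * k)) length-blocks))
      (trans (ℕP.^-*-assoc (suc (2 * M)) (ℓ ^ r) (length blocks))
        (trans (cong (suc (2 * M) ^_) (trans (cong (ℓ ^ r *_) length-blocks) (reorder (ℓ ^ r) s K)))
          (sym (trans (length-assignments-box _≟M_ (mPoints s t ℓ r) M) (cong (suc (2 * M) ^_) length-mPoints))))))
    where
    reorder : ∀ L s K → L * (s * K) ≡ s * (K * L)
    reorder = ℕSolver.solve-∀

  probability-bound : H ≤ M →
    probability ℓ r s t η H M n ℚ.* ℕtoℚ (M ^ (2 ^ r * s * K)) ℚ.* ℕtoℚ (H ^ (r * 2 ^ (r ∸ 1) * s * K))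
    ℚ.≤ ℕtoℚ C ℚ.* powℚ (1/ η) C′
  probability-bound H≤M =
    subst (λ q → q ℚ.* ℕtoℚ A ℚ.* ℕtoℚ B ℚ.≤ ℕtoℚ C ℚ.* powℚ (1/ η) C′) (sym probability≡) (≃-≤ lhs≃ rhs≃ cross)
    where
    A = M ^ (2 ^ r * s * K)
    B = H ^ (r * 2 ^ (r ∸ 1) * s * K)
    instance
      hAmA-nonZero : NonZero (length hAssignments * length mAssignments)
      hAmA-nonZero = ℕP.m*n≢0 (length hAssignments) (length mAssignments)
      p^C′-nonZero : NonZero (suc p₀ ^ C′)
      p^C′-nonZero = ℕP.m^n≢0 (suc p₀) C′
    lhs≃ : ℕtoℚ total ℚ.* (+ 1 ℚ./ length hAssignments) ℚ.* (+ 1 ℚ./ length mAssignments) ℚ.* ℕtoℚ A ℚ.* ℕtoℚ B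
           ≃ total * A * B ∕ (length hAssignments * length mAssignments)
    lhs≃ = ≃-*ℕ (≃-*ℕ (≃-*1/ (ℕ*1/-≃ total (length hAssignments)) (length mAssignments)) A) B
    rhs≃ : ℕtoℚ C ℚ.* powℚ (1/ η) C′ ≃ C * suc d₀ ^ C′ ∕ suc p₀ ^ C′
    rhs≃ = ℕ*-≃ C (powℚ-≃ 1/η≃ C′)
    lhs : ∀ T P A B → T * (P * A * B) ≡ T * A * B * P
    lhs = ℕSolver.solve-∀
    rhs : ∀ h C D m → h * (C * D * m) ≡ C * D * (h * m)
    rhs = ℕSolver.solve-∀
    cross : total * A * B * suc p₀ ^ C′ ≤ C * suc d₀ ^ C′ * (length hAssignments * length mAssignments)
    cross = subst₂ _≤_ (lhs total (suc p₀ ^ C′) A B) (rhs (length hAssignments) C (suc d₀ ^ C′) (length mAssignments))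
              (subst₂ (λ w v → total * w ≤ length hAssignments * v) weight-total volume-total (total-≤ H≤M))

-- ℓ ≤ t only makes 𝒦 nonempty; the bound does not need it.
proposition7p5 : (ℓ r s t : ℕ) → 3 ≤ ℓ → ℓ ≤ t →
  Σ ℕ λ C → Σ ℕ λ C′ →
  (η : ℚ) → .{{_ : Positive η}} → (H M : ℕ) → 1 ≤ H → H ≤ M →
  (n : Fin s → Kidx t ℓ r → Vec Bool r → ℤ) →
  probability ℓ r s t η H M n
    ℚ.* ℕtoℚ (M ^ (2 ^ r * s * length (𝒦 t ℓ r)))
    ℚ.* ℕtoℚ (H ^ (r * 2 ^ (r ∸ 1) * s * length (𝒦 t ℓ r)))
    ℚ.≤ ℕtoℚ C ℚ.* powℚ (1/_ η {{pos⇒nonZero η}}) C′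
proposition7p5 (suc zero)            _ _ _ (s≤s ()) _
proposition7p5 (suc (suc zero))      _ _ _ (s≤s (s≤s ())) _
proposition7p5 (suc (suc (suc ℓ′))) r s t _ _ =
  codeConstant ℓ′ r ^ (s * length (𝒦 t ℓ r)) , ηExponent ℓ r * (s * length (𝒦 t ℓ r)) , bound
  where
  ℓ = suc (suc (suc ℓ′))
  bound : (η : ℚ) → .{{_ : Positive η}} → (H M : ℕ) → 1 ≤ H → H ≤ M →
    (n : Fin s → Kidx t ℓ r → Vec Bool r → ℤ) →
    probability ℓ r s t η H M n
      ℚ.* ℕtoℚ (M ^ (2 ^ r * s * length (𝒦 t ℓ r)))
      ℚ.* ℕtoℚ (H ^ (r * 2 ^ (r ∸ 1) * s * length (𝒦 t ℓ r)))
      ℚ.≤ ℕtoℚ (codeConstant ℓ′ r ^ (s * length (𝒦 t ℓ r))) ℚ.* powℚ (1/_ η {{pos⇒nonZero η}}) (ηExponent ℓ r * (s * length (𝒦 t ℓ r)))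
  bound (mkℚ +[1+ p₀ ] d₀ coprime) H M 1≤H H≤M n =
    Counting.probability-bound ℓ′ t r s p₀ d₀ (recompute coprime) H M {{ℕ.>-nonZero 1≤H}} n H≤M
  bound (mkℚ (+ zero) _ _) {{positive}} = ⊥-elim-irr (ℤ.Positive.pos positive)
  bound (mkℚ -[1+ _ ] _ _) {{positive}} = ⊥-elim-irr (ℤ.Positive.pos positive)
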